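{- Let $G$ be an $r$-regular graph with $n$ vertices, let $k\ge 0$ be an integer and let $S(G)$ be the $3k$-subdivision of $G$. The following are equivalent: (i) $S(G)$ admits a perfect edge dominating set of size $\frac{nr}{2(2r-1)}\cdot(2rk-k+1)$; (ii) the vertices of $G$ can be coloured with two colours $W$ and $Y$ such that no two vertices coloured $W$ are adjacent, and every vertex coloured $Y$ has exactly one neighbour in $G$ coloured $Y$; (iii) $G$ admits an efficient edge dominating set.
   Context: Graphs are finite, simple and undirected. An edge dominates itself and every edge sharing an endpoint with it. A set $P\subseteq E(H)$ is a perfect edge dominating set if every edge of $E(H)\setminus P$ is dominated by exactly one edge of $P$, and an efficient edge dominating set if every edge of $E(H)$ is dominated by exactly one edge of $P$. For an integer $m\ge0$, the $m$-subdivision $S(G)$ of $G$ is obtained by replacing each edge $vw$ by a path from $v$ to $w$ with $m+1$ edges whose $m$ internal vertices are new vertices of degree 2; here $m=3k$. -}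

module Defs where

open import Data.Nat using (ℕ; _+_; _*_)
open import Data.Fin using (Fin; _↑ˡ_; _↑ʳ_; combine; _≟_)
open import Data.Fin.Properties using () renaming (_≟_ to _≟ᶠ_)
open import Data.List using (List; []; _∷_; length; filter; map; concatMap; lookup; allFin)
open import Data.List.Membership.Propositional using (_∈_; _∉_)
open import Data.List.Relation.Unary.All using (All)
open import Data.List.Relation.Unary.AllPairs using (AllPairs)
open import Data.List.Relation.Unary.Unique.Propositional using (Unique)
open import Data.Product using (_×_; _,_; proj₁; proj₂; Σ; ∃; swap)
open import Data.Sum using (_⊎_)
open import Data.Empty using (⊥)
open import Relation.Nullary using (¬_; Dec)
open import Relation.Nullary.Decidable using (_⊎-dec_)
open import Relation.Binary.PropositionalEquality using (_≡_; _≢_)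

-- Graphs on the vertex set Fin n, given by an edge list in which every
-- edge {u,v} appears exactly once (in one orientation (u , v)).

Edge : ℕ → Set
Edge n = Fin n × Fin n

SameEdge : ∀ {n} → Edge n → Edge n → Set
SameEdge e f = (e ≡ f) ⊎ (swap e ≡ f)

record Graph (n : ℕ) : Set where
  field
    edges    : List (Edge n)
    loopless : All (λ e → proj₁ e ≢ proj₂ e) edges
    noMulti  : AllPairs (λ e f → ¬ SameEdge e f) edges
open Graph public

Adjacent : ∀ {n} → Graph n → Fin n → Fin n → Set
Adjacent G u v = ((u , v) ∈ edges G) ⊎ ((v , u) ∈ edges G)

Incident : ∀ {n} → Fin n → Edge n → Set
Incident v e = (proj₁ e ≡ v) ⊎ (proj₂ e ≡ v)

incident? : ∀ {n} (v : Fin n) (e : Edge n) → Dec (Incident v e)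
incident? v e = (proj₁ e ≟ᶠ v) ⊎-dec (proj₂ e ≟ᶠ v)

degree : ∀ {n} → Graph n → Fin n → ℕ
degree G v = length (filter (incident? v) (edges G))

Regular : ∀ {n} → ℕ → Graph n → Set
Regular {n} r G = (v : Fin n) → degree G v ≡ r

-- Edge domination on an edge list (of a graph on Fin N).
-- e dominates f iff they share an endpoint (so every edge dominates itself).

Dominates : ∀ {N} → Edge N → Edge N → Set
Dominates e f = Incident (proj₁ e) f ⊎ Incident (proj₂ e) f

dominates? : ∀ {N} (e f : Edge N) → Dec (Dominates e f)
dominates? e f = incident? (proj₁ e) f ⊎-dec incident? (proj₂ e) f

domCount : ∀ {N} → List (Edge N) → Edge N → ℕ
domCount P f = length (filter (λ e → dominates? e f) P)

EdgeSubset : ∀ {N} → List (Edge N) → List (Edge N) → Set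
EdgeSubset E P = Unique P × All (_∈ E) P

IsPerfectEDS : ∀ {N} → List (Edge N) → List (Edge N) → Set
IsPerfectEDS E P = EdgeSubset E P ×
  (∀ f → f ∈ E → f ∉ P → domCount P f ≡ 1)

IsEfficientEDS : ∀ {N} → List (Edge N) → List (Edge N) → Set
IsEfficientEDS E P = EdgeSubset E P × (∀ f → f ∈ E → domCount P f ≡ 1)

-- Vertex set Fin (n + |E| * m): old vertex v is v ↑ˡ _,
-- the j-th internal vertex on the path replacing the i-th edge is
-- n ↑ʳ combine i j.  The edge (v , w) becomes the path
-- v - x_0 - x_1 - ... - x_{m-1} - w  (m + 1 edges).

pathEdges : ∀ {A : Set} → A → List A → A → List (A × A)
pathEdges a []       b = (a , b) ∷ []
pathEdges a (x ∷ xs) b = (a , x) ∷ pathEdges x xs b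

subdivVertices : ∀ {n} → ℕ → Graph n → ℕ
subdivVertices {n} m G = n + length (edges G) * m

subdivEdges : ∀ {n} (m : ℕ) (G : Graph n) → List (Edge (subdivVertices m G))
subdivEdges {n} m G = concatMap pathFor (allFin L)
  where
  L = length (edges G)
  old : Fin n → Fin (n + L * m)
  old v = v ↑ˡ (L * m)
  pathFor : Fin L → List (Edge (n + L * m))
  pathFor i = pathEdges (old (proj₁ (lookup (edges G) i)))
                        (map (λ j → n ↑ʳ combine i j) (allFin m))
                        (old (proj₂ (lookup (edges G) i)))

data Colour : Set where
  W Y : Colour

ColouringII : ∀ {n} → Graph n → (Fin n → Colour) → Set
ColouringII {n} G c =
  (∀ u v → Adjacent G u v → c u ≡ W → c v ≡ W → ⊥) ×
  (∀ v → c v ≡ Y →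
     Σ (Fin n) λ u → Adjacent G v u × c u ≡ Y ×
       (∀ u′ → Adjacent G v u′ → c u′ ≡ Y → u′ ≡ u))

{-# OPTIONS --safe #-}
module Submission where

-- (ii) ⇔ (iii): for an edge xy of G and a set M of edges, the number of edges of M dominating xy
-- plus [xy ∈ M] equals deg_M x + deg_M y.  So colouring Y the vertices covered by an efficient M gives
-- (ii), and conversely the edges with both ends Y form an efficient set.
--
-- (i) ⇔ (ii): a set P of edges of S(G) is perfect iff, along every subdivided edge, the word recording
-- which of its 3k+1 edges lie in P obeys a local rule involving the P-degrees D of its two old ends.
-- Give an end of a subdivided edge the weight r if its end edge lies in P and 1 ∸ D otherwise.  The r
-- ends at a vertex weigh at least r, with equality only if D ≤ 1, and the two ends of a path weigh at
-- most (2r−1)(ones − k) + 1.  Summed over G both bounds total nr under the size hypothesis, so all are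
-- tight: D ≤ 1 everywhere, and every path either starts and ends in P or has D = 1 at exactly one end.
-- So D = 1 ↦ Y is a colouring as in (ii) (for r ≤ 1 one exists anyway).  Conversely the words
-- (100)ᵏ1, (001)ᵏ0 and (010)ᵏ0 on Y–Y, Y–W and W–Y edges meet every bound with equality.

open import Defs
open import Data.Nat using (ℕ; zero; suc; _+_; _*_; _∸_; _≤_; z≤n; s≤s; >-nonZero)
open import Data.Nat.Properties
open import Data.Nat.Tactic.RingSolver using (solve-∀)
open import Data.Bool using (Bool; true; false; _∧_; _∨_)
open import Data.Bool.Properties using (∧-identityʳ; ∧-zeroʳ)
open import Data.Fin using (Fin; zero; suc; _↑ˡ_; _↑ʳ_; combine; splitAt)
open import Data.Fin.Properties using (↑ˡ-injective; ↑ʳ-injective; combine-injective; splitAt-↑ˡ; splitAt-↑ʳ) renaming (_≟_ to _≟ᶠ_; suc-injective to suc-injectiveᶠ)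
open import Data.List using (List; []; _∷_; length; filter; map; tabulate; concatMap; _++_; lookup; allFin)
open import Data.List.Properties using (length-map; length-tabulate; map-tabulate; tabulate-lookup)
open import Data.List.Membership.Propositional using (_∈_; _∉_; lose)
open import Data.List.Membership.Propositional.Properties using (∈-concatMap⁺; ∈-concatMap⁻; ∈-allFin; ∈-lookup; ∈-map⁺; ∈-map⁻; ∈-filter⁺; ∈-filter⁻)
open import Data.List.Relation.Unary.Any using (here; there; satisfied; index)
open import Data.List.Relation.Unary.Any.Properties using (lookup-index)
open import Data.List.Relation.Unary.All using (All; []; _∷_)
import Data.List.Relation.Unary.All as All
open import Data.List.Relation.Unary.All.Properties using () renaming (tabulate⁺ to All-tabulate⁺)
open import Data.List.Relation.Unary.AllPairs using (AllPairs; []; _∷_)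
import Data.List.Relation.Unary.AllPairs.Properties as AllPairs
open import Data.List.Relation.Binary.Disjoint.Propositional using (Disjoint)
open import Data.List.Relation.Unary.Unique.Propositional using (Unique)
open import Data.List.Relation.Unary.Unique.Propositional.Properties using (filter⁺; map⁺; map⁻; allFin⁺; concat⁺)
open import Data.Product using (_×_; _,_; proj₁; proj₂; Σ; swap)
open import Data.Product.Properties using (≡-dec)
open import Data.Sum using (_⊎_; inj₁; inj₂)
open import Data.Empty using (⊥; ⊥-elim)
open import Data.Unit using (⊤; tt)
open import Relation.Nullary using (¬_; Dec; yes; no; does)
open import Relation.Nullary.Decidable using (_⊎-dec_; _×-dec_; dec-true; dec-false; decidable-stable)
open import Relation.Unary using (Pred; Decidable)
open import Relation.Binary.Definitions using (DecidableEquality)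
open import Relation.Binary.PropositionalEquality
open import Function.Bundles using (_⇔_; mk⇔; Equivalence)
open import Algebra.Properties.Semiring.Sum +-*-semiring using (sum; sum-syntax; sum-cong-≗; ∑-distrib-+; ∑-comm; *-distribˡ-sum)

bit : Bool → ℕ
bit true  = 1
bit false = 0

𝟙 : {P : Set} → Dec P → ℕ
𝟙 d = bit (does d)

module _ {P : Set} where

  𝟙-yes : (d : Dec P) → P → 𝟙 d ≡ 1
  𝟙-yes d p = cong bit (dec-true d p)

  𝟙-no : (d : Dec P) → ¬ P → 𝟙 d ≡ 0
  𝟙-no d ¬p = cong bit (dec-false d ¬p)

  𝟙≥1⇒ : (d : Dec P) → 1 ≤ 𝟙 d → P
  𝟙≥1⇒ (yes p) _ = p

  𝟙≤1 : (d : Dec P) → 𝟙 d ≤ 1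
  𝟙≤1 (yes _) = s≤s z≤n
  𝟙≤1 (no _)  = z≤n

  𝟙-cong : {Q : Set} (p : Dec P) (q : Dec Q) → (P → Q) → (Q → P) → 𝟙 p ≡ 𝟙 q
  𝟙-cong (yes _) (yes _) _ _ = refl
  𝟙-cong (no _)  (no _)  _ _ = refl
  𝟙-cong (yes p) (no ¬q) f _ = ⊥-elim (¬q (f p))
  𝟙-cong (no ¬p) (yes q) _ g = ⊥-elim (¬p (g q))

𝟙-×-yes : {P Q : Set} (p : Dec P) (q : Dec Q) → Q → 𝟙 (p ×-dec q) ≡ 𝟙 p
𝟙-×-yes p (yes _) _  = cong bit (∧-identityʳ (does p))
𝟙-×-yes p (no ¬q) q = ⊥-elim (¬q q)

𝟙-×-no : {P Q : Set} (p : Dec P) (q : Dec Q) → ¬ Q → 𝟙 (p ×-dec q) ≡ 0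
𝟙-×-no p (yes q) ¬q = ⊥-elim (¬q q)
𝟙-×-no p (no _)  _  = cong bit (∧-zeroʳ (does p))

+≥1⇒ : ∀ x {y} → 1 ≤ x + y → (1 ≤ x) ⊎ (1 ≤ y)
+≥1⇒ zero    h = inj₂ h
+≥1⇒ (suc _) _ = inj₁ (s≤s z≤n)

𝟙*bit≥1⇒ : ∀ {P : Set} (p : Dec P) b → 1 ≤ 𝟙 p * bit b → P × (b ≡ true)
𝟙*bit≥1⇒ (yes p) true _ = p , refl

𝟙*[1∸bit]≥1⇒ : ∀ {P : Set} (p : Dec P) b → 1 ≤ 𝟙 p * (1 ∸ bit b) → P × (b ≡ false)
𝟙*[1∸bit]≥1⇒ (yes p) false _ = p , refl

≱1⇒≡0 : ∀ {x} → ¬ (1 ≤ x) → x ≡ 0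
≱1⇒≡0 x≱1 = n<1⇒n≡0 (≰⇒> x≱1)

bit-∨+bit-∧ : ∀ a b → bit (a ∨ b) + bit (a ∧ b) ≡ bit a + bit b
bit-∨+bit-∧ true  true  = refl
bit-∨+bit-∧ true  false = refl
bit-∨+bit-∧ false true  = refl
bit-∨+bit-∧ false false = refl

+-interchange : ∀ a b c d → (a + b) + (c + d) ≡ (a + c) + (b + d)
+-interchange = solve-∀

module _ {A : Set} where

  count : {P : Pred A _} → Decidable P → List A → ℕ
  count P? []       = 0
  count P? (x ∷ xs) = 𝟙 (P? x) + count P? xs

  length-filter : {P : Pred A _} (P? : Decidable P) (xs : List A) →
    length (filter P? xs) ≡ count P? xs
  length-filter P? [] = refl
  length-filter P? (x ∷ xs) with P? x
  ... | yes _ = cong suc (length-filter P? xs)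
  ... | no _  = length-filter P? xs

  count-filter : {P Q : Pred A _} (P? : Decidable P) (Q? : Decidable Q) (xs : List A) →
    count Q? (filter P? xs) ≡ count (λ x → P? x ×-dec Q? x) xs
  count-filter P? Q? [] = refl
  count-filter P? Q? (x ∷ xs) with P? x
  ... | yes _ = cong (𝟙 (Q? x) +_) (count-filter P? Q? xs)
  ... | no _  = count-filter P? Q? xs

  count-++ : {P : Pred A _} (P? : Decidable P) (xs ys : List A) →
    count P? (xs ++ ys) ≡ count P? xs + count P? ys
  count-++ P? []       ys = refl
  count-++ P? (x ∷ xs) ys =
    trans (cong (𝟙 (P? x) +_) (count-++ P? xs ys)) (sym (+-assoc (𝟙 (P? x)) _ _))

  count-cong : {P Q : Pred A _} (P? : Decidable P) (Q? : Decidable Q) (xs : List A) →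
    (∀ x → x ∈ xs → P x → Q x) → (∀ x → x ∈ xs → Q x → P x) → count P? xs ≡ count Q? xs
  count-cong P? Q? []       f g = refl
  count-cong P? Q? (x ∷ xs) f g =
    cong₂ _+_ (𝟙-cong (P? x) (Q? x) (f x (here refl)) (g x (here refl)))
              (count-cong P? Q? xs (λ y y∈ → f y (there y∈)) (λ y y∈ → g y (there y∈)))

  count≡0 : {P : Pred A _} (P? : Decidable P) (xs : List A) →
    (∀ x → x ∈ xs → ¬ P x) → count P? xs ≡ 0
  count≡0 P? []       f = refl
  count≡0 P? (x ∷ xs) f =
    cong₂ _+_ (𝟙-no (P? x) (f x (here refl))) (count≡0 P? xs (λ y y∈ → f y (there y∈)))

  count≥1⇒∃ : {P : Pred A _} (P? : Decidable P) (xs : List A) →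
    1 ≤ count P? xs → Σ A λ x → x ∈ xs × P x
  count≥1⇒∃ P? (x ∷ xs) h with P? x
  ... | yes p = x , here refl , p
  ... | no _ with count≥1⇒∃ P? xs h
  ...   | y , y∈ , py = y , there y∈ , py

  ∈⇒count≥1 : {P : Pred A _} (P? : Decidable P) {xs : List A} {x : A} →
    x ∈ xs → P x → 1 ≤ count P? xs
  ∈⇒count≥1 P? {x ∷ _} (here refl) px rewrite 𝟙-yes (P? x) px = s≤s z≤n
  ∈⇒count≥1 P? {y ∷ _} (there x∈) px = ≤-trans (∈⇒count≥1 P? x∈ px) (m≤n+m _ _)

  ∈⇒count≥2 : {P : Pred A _} (P? : Decidable P) {xs : List A} {x y : A} →
    x ∈ xs → y ∈ xs → x ≢ y → P x → P y → 2 ≤ count P? xs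
  ∈⇒count≥2 P? (here refl) (here refl) x≢y _ _ = ⊥-elim (x≢y refl)
  ∈⇒count≥2 P? {x ∷ _} (here refl) (there y∈) _ px py
    rewrite 𝟙-yes (P? x) px = s≤s (∈⇒count≥1 P? y∈ py)
  ∈⇒count≥2 P? {y ∷ _} (there x∈) (here refl) _ px py
    rewrite 𝟙-yes (P? y) py = s≤s (∈⇒count≥1 P? x∈ px)
  ∈⇒count≥2 P? (there x∈) (there y∈) x≢y px py =
    ≤-trans (∈⇒count≥2 P? x∈ y∈ x≢y px py) (m≤n+m _ _)

  count-⊎+count-× : {P Q : Pred A _} (P? : Decidable P) (Q? : Decidable Q) (xs : List A) →
    count (λ x → P? x ⊎-dec Q? x) xs + count (λ x → P? x ×-dec Q? x) xs ≡ count P? xs + count Q? xs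
  count-⊎+count-× P? Q? [] = refl
  count-⊎+count-× P? Q? (x ∷ xs) = begin
    (bit (p ∨ q) + c⊎) + (bit (p ∧ q) + c×)  ≡⟨ +-interchange (bit (p ∨ q)) c⊎ (bit (p ∧ q)) c× ⟩
    (bit (p ∨ q) + bit (p ∧ q)) + (c⊎ + c×)  ≡⟨ cong₂ _+_ (bit-∨+bit-∧ p q) (count-⊎+count-× P? Q? xs) ⟩
    (bit p + bit q) + (cP + cQ)              ≡⟨ +-interchange (bit p) (bit q) cP cQ ⟩
    (bit p + cP) + (bit q + cQ)              ∎
    where
    open ≡-Reasoning
    p = does (P? x)
    q = does (Q? x)
    c⊎ = count (λ x → P? x ⊎-dec Q? x) xs
    c× = count (λ x → P? x ×-dec Q? x) xs
    cP = count P? xs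
    cQ = count Q? xs

  count-unique : {P : Pred A _} (P? : Decidable P) {xs : List A} → Unique xs →
    {x : A} → x ∈ xs → P x → (∀ y → y ∈ xs → P y → y ≡ x) → count P? xs ≡ 1
  count-unique P? {y ∷ xs} (y∉ ∷ u) (here refl) px only =
    cong₂ _+_ (𝟙-yes (P? y) px)
              (count≡0 P? xs λ z z∈ pz → All.lookup y∉ z∈ (sym (only z (there z∈) pz)))
  count-unique P? {y ∷ xs} (y∉ ∷ u) (there x∈) px only =
    cong₂ _+_ (𝟙-no (P? y) λ py → All.lookup y∉ x∈ (only y (here refl) py))
              (count-unique P? u x∈ px (λ z z∈ → only z (there z∈)))

  count-disjoint : {P Q : Pred A _} (P? : Decidable P) (Q? : Decidable Q) (xs : List A) →
    (∀ x → x ∈ xs → P x → Q x → ⊥) →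
    count (λ x → P? x ⊎-dec Q? x) xs ≡ count P? xs + count Q? xs
  count-disjoint P? Q? xs disj = begin
    c⊎                        ≡⟨ +-identityʳ c⊎ ⟨
    c⊎ + 0                    ≡⟨ cong (c⊎ +_) none ⟨
    c⊎ + count (λ x → P? x ×-dec Q? x) xs ≡⟨ count-⊎+count-× P? Q? xs ⟩
    count P? xs + count Q? xs ∎
    where
    open ≡-Reasoning
    c⊎ = count (λ x → P? x ⊎-dec Q? x) xs
    none = count≡0 (λ x → P? x ×-dec Q? x) xs λ x x∈ (p , q) → disj x x∈ p q

  module _ (_≟_ : DecidableEquality A) where
    open import Data.List.Membership.DecPropositional _≟_ using (_∈?_)

    count-sublist : {Q : Pred A _} (Q? : Decidable Q) {xs ys : List A} →
      Unique xs → All (_∈ ys) xs → Unique ys →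
      count Q? xs ≡ count (λ y → (y ∈? xs) ×-dec Q? y) ys
    count-sublist Q? {[]} {ys} _ _ _ = sym (count≡0 _ ys λ _ _ ())
    count-sublist {Q} Q? {x ∷ xs} {ys} (x∉ ∷ uxs) (x∈ys ∷ xs⊆ys) uys = begin
      𝟙 (Q? x) + count Q? xs                                  ≡⟨ cong₂ _+_ head-term (count-sublist Q? uxs xs⊆ys uys) ⟩
      count isX ys + count inXs ys                            ≡⟨ count-disjoint isX inXs ys disj ⟨
      count (λ y → isX y ⊎-dec inXs y) ys                     ≡⟨ count-cong _ _ ys split merge ⟩
      count (λ y → (y ∈? (x ∷ xs)) ×-dec Q? y) ys             ∎
      where
      open ≡-Reasoning
      isX = λ y → (y ≟ x) ×-dec Q? y
      inXs = λ y → (y ∈? xs) ×-dec Q? y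
      head-term : 𝟙 (Q? x) ≡ count isX ys
      head-term with Q? x
      ... | yes q = sym (count-unique isX uys x∈ys (refl , q) λ { y _ (y≡x , _) → y≡x })
      ... | no ¬q = sym (count≡0 isX ys λ { y _ (refl , q) → ¬q q })
      disj : ∀ y → y ∈ ys → (y ≡ x) × Q y → y ∈ xs × Q y → ⊥
      disj y _ (refl , _) (y∈xs , _) = All.lookup x∉ y∈xs refl
      split : ∀ y → y ∈ ys → ((y ≡ x) × Q y) ⊎ (y ∈ xs × Q y) → y ∈ x ∷ xs × Q y
      split y _ (inj₁ (refl , q)) = here refl , q
      split y _ (inj₂ (y∈ , q))   = there y∈ , q
      merge : ∀ y → y ∈ ys → y ∈ x ∷ xs × Q y → ((y ≡ x) × Q y) ⊎ (y ∈ xs × Q y)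
      merge y _ (here refl , q) = inj₁ (refl , q)
      merge y _ (there y∈ , q)  = inj₂ (y∈ , q)

∑-const : ∀ n c → ∑[ i < n ] c ≡ n * c
∑-const zero    c = refl
∑-const (suc n) c = cong (c +_) (∑-const n c)

∑-mono-≤ : ∀ n {f g : Fin n → ℕ} → (∀ i → f i ≤ g i) → sum f ≤ sum g
∑-mono-≤ zero    h = z≤n
∑-mono-≤ (suc n) h = +-mono-≤ (h zero) (∑-mono-≤ n (λ i → h (suc i)))

∑-mono-≤-≡⇒≡ : ∀ n {f g : Fin n → ℕ} → (∀ i → f i ≤ g i) → sum f ≡ sum g → ∀ i → f i ≡ g i
∑-mono-≤-≡⇒≡ (suc n) {f} {g} h eq zero =
  ≤-antisym (h zero) (+-cancelʳ-≤ (sum (λ i → f (suc i))) _ _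
    (subst (g zero + sum (λ i → f (suc i)) ≤_) (sym eq)
      (+-monoʳ-≤ (g zero) (∑-mono-≤ n (λ i → h (suc i))))))
∑-mono-≤-≡⇒≡ (suc n) {f} {g} h eq (suc i) =
  ∑-mono-≤-≡⇒≡ n (λ i → h (suc i))
    (+-cancelˡ-≡ (f zero) _ _
      (trans eq (cong (_+ sum (λ i → g (suc i))) (sym (∑-mono-≤-≡⇒≡ (suc n) h eq zero))))) i

≤∑ : ∀ n (f : Fin n → ℕ) i → f i ≤ sum f
≤∑ (suc n) f zero    = m≤m+n _ _
≤∑ (suc n) f (suc i) = ≤-trans (≤∑ n (λ i → f (suc i)) i) (m≤n+m _ _)

+≤∑ : ∀ n (f : Fin n → ℕ) i j → i ≢ j → f i + f j ≤ sum f
+≤∑ (suc n) f zero    zero    i≢j = ⊥-elim (i≢j refl)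
+≤∑ (suc n) f zero    (suc j) _   = +-monoʳ-≤ (f zero) (≤∑ n (λ i → f (suc i)) j)
+≤∑ (suc n) f (suc i) zero    _   =
  subst (_≤ sum f) (+-comm (f zero) _) (+-monoʳ-≤ (f zero) (≤∑ n (λ i → f (suc i)) i))
+≤∑ (suc n) f (suc i) (suc j) i≢j =
  ≤-trans (+≤∑ n (λ i → f (suc i)) i j (λ eq → i≢j (cong suc eq))) (m≤n+m _ _)

∑≥1⇒∃ : ∀ n (f : Fin n → ℕ) → 1 ≤ sum f → Σ (Fin n) λ i → 1 ≤ f i
∑≥1⇒∃ (suc n) f h with f zero in eq
... | suc _ = zero , subst (1 ≤_) (sym eq) (s≤s z≤n)
... | zero with ∑≥1⇒∃ n (λ i → f (suc i)) h
...   | i , p = suc i , p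

∑≤1⇒unique : ∀ n (f : Fin n → ℕ) → sum f ≤ 1 → ∀ i j → 1 ≤ f i → 1 ≤ f j → i ≡ j
∑≤1⇒unique n f h i j fi fj with i ≟ᶠ j
... | yes i≡j = i≡j
... | no  i≢j = ⊥-elim (1+n≰n (≤-trans (+-mono-≤ fi fj) (≤-trans (+≤∑ n f i j i≢j) h)))

∑-pick : ∀ n (p : Fin n) (g : Fin n → ℕ) → ∑[ v < n ] (𝟙 (p ≟ᶠ v) * g v) ≡ g p
∑-pick (suc n) zero g = begin
  g zero + 0 + ∑[ v < n ] (𝟙 (zero ≟ᶠ suc v) * g (suc v))  ≡⟨ cong (g zero + 0 +_) rest≡0 ⟩
  g zero + 0 + 0                                           ≡⟨ trans (+-identityʳ _) (+-identityʳ _) ⟩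
  g zero                                                   ∎
  where
  open ≡-Reasoning
  rest≡0 : ∑[ v < n ] (𝟙 (zero ≟ᶠ suc v) * g (suc v)) ≡ 0
  rest≡0 = trans (sum-cong-≗ λ v → cong (_* g (suc v)) (𝟙-no (zero ≟ᶠ suc v) λ ()))
                 (trans (∑-const n 0) (*-zeroʳ n))
∑-pick (suc n) (suc p) g = begin
  0 * g zero + ∑[ v < n ] (𝟙 (suc p ≟ᶠ suc v) * g (suc v))  ≡⟨ sum-cong-≗ (λ v → cong (_* g (suc v)) (same v)) ⟩
  ∑[ v < n ] (𝟙 (p ≟ᶠ v) * g (suc v))                       ≡⟨ ∑-pick n p (λ v → g (suc v)) ⟩
  g (suc p)                                                 ∎
  where
  open ≡-Reasoning
  same : ∀ v → 𝟙 (suc p ≟ᶠ suc v) ≡ 𝟙 (p ≟ᶠ v)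
  same v = 𝟙-cong (suc p ≟ᶠ suc v) (p ≟ᶠ v) suc-injectiveᶠ (cong suc)

∑-single : ∀ n (f : Fin n → ℕ) i → (∀ j → j ≢ i → f j ≡ 0) → sum f ≡ f i
∑-single n f i others = trans (sum-cong-≗ spread) (∑-pick n i f)
  where
  spread : ∀ j → f j ≡ 𝟙 (i ≟ᶠ j) * f j
  spread j with i ≟ᶠ j
  ... | yes refl = sym (+-identityʳ _)
  ... | no i≢j   = others j (λ j≡i → i≢j (sym j≡i))

count-tabulate : ∀ {A : Set} {P : Pred A _} (P? : Decidable P) n (g : Fin n → A) →
  count P? (tabulate g) ≡ ∑[ i < n ] 𝟙 (P? (g i))
count-tabulate P? zero    g = refl
count-tabulate P? (suc n) g = cong (𝟙 (P? (g zero)) +_) (count-tabulate P? n (λ i → g (suc i)))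

count-concatMap : ∀ {A : Set} {P : Pred A _} (P? : Decidable P) n (g : Fin n → List A) →
  count P? (concatMap g (allFin n)) ≡ ∑[ i < n ] count P? (g i)
count-concatMap P? n g = go n (λ i → i)
  where
  go : ∀ m (h : Fin m → Fin n) → count P? (concatMap g (tabulate h)) ≡ ∑[ i < m ] count P? (g (h i))
  go zero    h = refl
  go (suc m) h = trans (count-++ P? (g (h zero)) _)
                       (cong (count P? (g (h zero)) +_) (go m (λ i → h (suc i))))

_≟ₑ_ : ∀ {N} → DecidableEquality (Edge N)
_≟ₑ_ = ≡-dec _≟ᶠ_ _≟ᶠ_

module _ {N : ℕ} where
  open import Data.List.Membership.DecPropositional (_≟ₑ_ {N}) public using (_∈?_)

Joins : ∀ {N} → Edge N → Fin N → Fin N → Set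
Joins f v u = (f ≡ (v , u)) ⊎ (f ≡ (u , v))

Joins-sym : ∀ {N} {f : Edge N} {v u} → Joins f v u → Joins f u v
Joins-sym (inj₁ eq) = inj₂ eq
Joins-sym (inj₂ eq) = inj₁ eq

Joins⇒Incident : ∀ {N} {f : Edge N} {v u} → Joins f v u → Incident v f
Joins⇒Incident (inj₁ refl) = inj₁ refl
Joins⇒Incident (inj₂ refl) = inj₂ refl

Incident⇒Joins : ∀ {N} (f : Edge N) {v} → Incident v f → Σ (Fin N) λ u → Joins f v u
Incident⇒Joins (a , b) (inj₁ refl) = b , inj₁ refl
Incident⇒Joins (a , b) (inj₂ refl) = a , inj₂ refl

Joins-+ : ∀ {N} (d : Fin N → ℕ) {f : Edge N} {v u} → Joins f v u → d (proj₁ f) + d (proj₂ f) ≡ d v + d u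
Joins-+ d           (inj₁ refl) = refl
Joins-+ d {v = v} {u} (inj₂ refl) = +-comm (d u) (d v)

Loopless : ∀ {N} → List (Edge N) → Set
Loopless E = ∀ {f} → f ∈ E → proj₁ f ≢ proj₂ f

Antisymmetric : ∀ {N} → List (Edge N) → Set
Antisymmetric E = ∀ {f} → f ∈ E → swap f ∉ E

Joins-unique : ∀ {N} {E : List (Edge N)} → Loopless E → Antisymmetric E →
  ∀ {f g v u} → f ∈ E → g ∈ E → Joins f v u → Joins g v u → f ≡ g
Joins-unique LE AE f∈ g∈ (inj₁ refl) (inj₁ refl) = refl
Joins-unique LE AE f∈ g∈ (inj₂ refl) (inj₂ refl) = refl
Joins-unique LE AE f∈ g∈ (inj₁ refl) (inj₂ refl) = ⊥-elim (AE g∈ f∈)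
Joins-unique LE AE f∈ g∈ (inj₂ refl) (inj₁ refl) = ⊥-elim (AE g∈ f∈)

Joins-other : ∀ {N} {E : List (Edge N)} → Loopless E →
  ∀ {f v u u′} → f ∈ E → Joins f v u → Joins f v u′ → u′ ≡ u
Joins-other LE f∈ (inj₁ refl) (inj₁ refl) = refl
Joins-other LE f∈ (inj₂ refl) (inj₂ refl) = refl
Joins-other LE f∈ (inj₁ refl) (inj₂ refl) = ⊥-elim (LE f∈ refl)
Joins-other LE f∈ (inj₂ refl) (inj₁ refl) = ⊥-elim (LE f∈ refl)

degreeIn : ∀ {N} → List (Edge N) → Fin N → ℕ
degreeIn P z = count (incident? z) P

-- An edge of P meeting both ends of f is f itself, so f ∈ P is counted at both of its ends.
domCount-formula : ∀ {N} {E P : List (Edge N)} → Loopless E → Antisymmetric E →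
  Unique P → All (_∈ E) P → ∀ {f} → f ∈ E →
  domCount P f + 𝟙 (f ∈? P) ≡ degreeIn P (proj₁ f) + degreeIn P (proj₂ f)
domCount-formula {P = P} LE AE uP P⊆E {x , y} f∈ = begin
  domCount P (x , y) + 𝟙 ((x , y) ∈? P)
    ≡⟨ cong₂ _+_ (trans (length-filter _ P) (count-cong _ atX⊎atY P (λ _ _ → split) (λ _ _ → merge)))
                 (sym count-both) ⟩
  count atX⊎atY P + count atX×atY P
    ≡⟨ count-⊎+count-× (incident? x) (incident? y) P ⟩
  degreeIn P x + degreeIn P y ∎
  where
  open ≡-Reasoning
  atX⊎atY = λ e → incident? x e ⊎-dec incident? y e
  atX×atY = λ e → incident? x e ×-dec incident? y e
  split : ∀ {e} → Dominates e (x , y) → Incident x e ⊎ Incident y e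
  split (inj₁ (inj₁ refl)) = inj₁ (inj₁ refl)
  split (inj₁ (inj₂ refl)) = inj₂ (inj₁ refl)
  split (inj₂ (inj₁ refl)) = inj₁ (inj₂ refl)
  split (inj₂ (inj₂ refl)) = inj₂ (inj₂ refl)
  merge : ∀ {e} → Incident x e ⊎ Incident y e → Dominates e (x , y)
  merge (inj₁ (inj₁ refl)) = inj₁ (inj₁ refl)
  merge (inj₂ (inj₁ refl)) = inj₁ (inj₂ refl)
  merge (inj₁ (inj₂ refl)) = inj₂ (inj₁ refl)
  merge (inj₂ (inj₂ refl)) = inj₂ (inj₂ refl)
  both : ∀ e → e ∈ P → Incident x e × Incident y e → e ≡ (x , y)
  both e e∈ (inj₁ refl , inj₁ refl) = ⊥-elim (LE f∈ refl)
  both e e∈ (inj₁ refl , inj₂ refl) = refl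
  both e e∈ (inj₂ refl , inj₁ refl) = ⊥-elim (AE f∈ (All.lookup P⊆E e∈))
  both e e∈ (inj₂ refl , inj₂ refl) = ⊥-elim (LE f∈ refl)
  count-both : count atX×atY P ≡ 𝟙 ((x , y) ∈? P)
  count-both with (x , y) ∈? P
  ... | yes f∈P = count-unique atX×atY uP f∈P (inj₁ refl , inj₂ refl) both
  ... | no  f∉P = count≡0 atX×atY P λ e e∈ inc → f∉P (subst (_∈ P) (both e e∈ inc) e∈)

module _ {n : ℕ} (G : Graph n) where

  edges-loopless : Loopless (edges G)
  edges-loopless f∈ = All.lookup (loopless G) f∈

  edges-antisymmetric : Antisymmetric (edges G)
  edges-antisymmetric {a , b} f∈ s∈ = go (noMulti G) f∈ s∈
    where
    go : ∀ {E} → AllPairs (λ e f → ¬ SameEdge e f) E → (a , b) ∈ E → (b , a) ∈ E → ⊥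
    go (_ ∷ _)  (here refl) (here eq)  = edges-loopless f∈ (cong proj₂ eq)
    go (ne ∷ _) (here refl) (there s∈) = All.lookup ne s∈ (inj₂ refl)
    go (ne ∷ _) (there f∈′) (here refl) = All.lookup ne f∈′ (inj₂ refl)
    go (_ ∷ ps) (there f∈′) (there s∈) = go ps f∈′ s∈

  edges-unique : Unique (edges G)
  edges-unique = go (noMulti G)
    where
    go : ∀ {E} → AllPairs (λ e f → ¬ SameEdge e f) E → Unique E
    go []        = []
    go (ne ∷ ps) = All.map (λ ¬same eq → ¬same (inj₁ eq)) ne ∷ go ps

  Adjacent⇒Joins : ∀ {u v} → Adjacent G u v → Σ (Edge n) λ f → f ∈ edges G × Joins f u v
  Adjacent⇒Joins {u} {v} (inj₁ uv∈) = (u , v) , uv∈ , inj₁ refl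
  Adjacent⇒Joins {u} {v} (inj₂ vu∈) = (v , u) , vu∈ , inj₂ refl

  Joins⇒Adjacent : ∀ {f u v} → f ∈ edges G → Joins f u v → Adjacent G u v
  Joins⇒Adjacent f∈ (inj₁ refl) = inj₁ f∈
  Joins⇒Adjacent f∈ (inj₂ refl) = inj₂ f∈

  edges-domCount-formula : ∀ {P} → EdgeSubset (edges G) P → ∀ {f} → f ∈ edges G →
    domCount P f + 𝟙 (f ∈? P) ≡ degreeIn P (proj₁ f) + degreeIn P (proj₂ f)
  edges-domCount-formula (uP , P⊆E) = domCount-formula edges-loopless edges-antisymmetric uP P⊆E

W≢Y : W ≢ Y
W≢Y ()

_≟ᶜ_ : DecidableEquality Colour
W ≟ᶜ W = yes refl
Y ≟ᶜ Y = yes refl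
W ≟ᶜ Y = no λ ()
Y ≟ᶜ W = no λ ()

colourOf : ℕ → Colour
colourOf zero    = W
colourOf (suc _) = Y

colourOf-W : ∀ {d} → colourOf d ≡ W → d ≡ 0
colourOf-W {zero} _ = refl

colourOf-Y : ∀ {d} → colourOf d ≡ Y → 1 ≤ d
colourOf-Y {suc _} _ = s≤s z≤n

≥1⇒colourOf-Y : ∀ {d} → 1 ≤ d → colourOf d ≡ Y
≥1⇒colourOf-Y {suc _} _ = refl

module ColouringII⇔EfficientEDS {n : ℕ} (G : Graph n) where

  colouring : ∀ {M} → IsEfficientEDS (edges G) M → Σ (Fin n → Colour) (ColouringII G)
  colouring {M} (sub , dom1) = c , noWW , uniqueY
    where
    d = degreeIn M
    c : Fin n → Colour
    c v = colourOf (d v)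
    balance : ∀ {f u v} → f ∈ edges G → Joins f u v → 1 + 𝟙 (f ∈? M) ≡ d u + d v
    balance f∈ j = trans (cong (_+ 𝟙 (_ ∈? M)) (sym (dom1 _ f∈))) (trans (edges-domCount-formula G sub f∈) (Joins-+ d j))
    noWW : ∀ u v → Adjacent G u v → c u ≡ W → c v ≡ W → ⊥
    noWW u v adj cu cv =
      let f , f∈ , j = Adjacent⇒Joins G adj
      in 1+n≢0 (trans (balance f∈ j) (cong₂ _+_ (colourOf-W cu) (colourOf-W cv)))
    uniqueY : ∀ v → c v ≡ Y → Σ (Fin n) λ u → Adjacent G v u × c u ≡ Y ×
      (∀ u′ → Adjacent G v u′ → c u′ ≡ Y → u′ ≡ u)
    uniqueY v cv =
      let e , e∈M , v∈e = count≥1⇒∃ (incident? v) M (colourOf-Y cv)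
          u , e-vu = Incident⇒Joins e v∈e
          e∈E = All.lookup (proj₂ sub) e∈M
      in u , Joins⇒Adjacent G e∈E e-vu , ≥1⇒colourOf-Y (∈⇒count≥1 (incident? u) e∈M (Joins⇒Incident (Joins-sym e-vu))) ,
         λ u′ adj cu′ →
           let f , f∈E , f-vu′ = Adjacent⇒Joins G adj
               f∈M : f ∈ M
               f∈M = 𝟙≥1⇒ (f ∈? M) (+-cancelˡ-≤ 1 1 _ (≤-trans (+-mono-≤ (colourOf-Y cv) (colourOf-Y cu′))
                                                                (≤-reflexive (sym (balance f∈E f-vu′)))))
               dv≤1 : d v ≤ 1
               dv≤1 = +-cancelʳ-≤ (d u′) _ _ (≤-trans (≤-reflexive (sym (balance f∈E f-vu′)))
                                                        (+-monoʳ-≤ 1 (≤-trans (𝟙≤1 (f ∈? M)) (colourOf-Y cu′))))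
               f≡e : f ≡ e
               f≡e = decidable-stable (f ≟ₑ e) λ f≢e →
                       <⇒≱ (s≤s (s≤s z≤n))
                           (≤-trans (∈⇒count≥2 (incident? v) f∈M e∈M f≢e (Joins⇒Incident f-vu′) v∈e) dv≤1)
           in Joins-other (edges-loopless G) f∈E (subst (λ g → Joins g v u) (sym f≡e) e-vu) f-vu′

  efficientEDS : (c : Fin n → Colour) → ColouringII G c → Σ (List (Edge n)) (IsEfficientEDS (edges G))
  efficientEDS c (noWW , uniqueY) = M , sub , dom1
    where
    Y-ends? = λ (e : Edge n) → (c (proj₁ e) ≟ᶜ Y) ×-dec (c (proj₂ e) ≟ᶜ Y)
    M = filter Y-ends? (edges G)
    sub : EdgeSubset (edges G) M
    sub = filter⁺ Y-ends? (edges-unique G) , All.tabulate (λ e∈ → proj₁ (∈-filter⁻ Y-ends? e∈))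
    ∈M⇒Y-ends : ∀ {x y} → (x , y) ∈ M → c x ≡ Y × c y ≡ Y
    ∈M⇒Y-ends m = proj₂ (∈-filter⁻ Y-ends? {xs = edges G} m)
    d = degreeIn M
    dW : ∀ {z} → c z ≡ W → d z ≡ 0
    dW {z} cz = trans (count-filter Y-ends? (incident? z) (edges G))
      (count≡0 _ (edges G) λ { _ _ ((ca , _) , inj₁ refl) → W≢Y (trans (sym cz) ca)
                             ; _ _ ((_ , cb) , inj₂ refl) → W≢Y (trans (sym cz) cb) })
    dY : ∀ {z} → c z ≡ Y → d z ≡ 1
    dY {z} cz =
      let u , adj , cu , only = uniqueY z cz
          f , f∈ , f-zu = Adjacent⇒Joins G adj
          Y-ends : ∀ {g w} → Joins g z w → c w ≡ Y → c (proj₁ g) ≡ Y × c (proj₂ g) ≡ Y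
          Y-ends = λ { (inj₁ refl) cw → cz , cw ; (inj₂ refl) cw → cw , cz }
          other-Y : ∀ {g w} → Joins g z w → c (proj₁ g) ≡ Y × c (proj₂ g) ≡ Y → c w ≡ Y
          other-Y = λ { (inj₁ refl) (_ , cw) → cw ; (inj₂ refl) (cw , _) → cw }
          same : ∀ g → g ∈ edges G → (c (proj₁ g) ≡ Y × c (proj₂ g) ≡ Y) × Incident z g → g ≡ f
          same g g∈ (YY , z∈g) =
            let w , g-zw = Incident⇒Joins g z∈g
                w≡u = only w (Joins⇒Adjacent G g∈ g-zw) (other-Y g-zw YY)
            in Joins-unique (edges-loopless G) (edges-antisymmetric G) g∈ f∈ (subst (Joins g z) w≡u g-zw) f-zu
      in trans (count-filter Y-ends? (incident? z) (edges G))
               (count-unique _ (edges-unique G) f∈ (Y-ends f-zu cu , Joins⇒Incident f-zu) same)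
    dom1 : ∀ f → f ∈ edges G → domCount M f ≡ 1
    dom1 (x , y) f∈ = +-cancelʳ-≡ _ _ _ (trans (edges-domCount-formula G sub f∈) (by-colours (c x) (c y) refl refl))
      where
      not-in : c x ≡ W ⊎ c y ≡ W → 𝟙 ((x , y) ∈? M) ≡ 0
      not-in (inj₁ cx) = 𝟙-no ((x , y) ∈? M) λ m → W≢Y (trans (sym cx) (proj₁ (∈M⇒Y-ends m)))
      not-in (inj₂ cy) = 𝟙-no ((x , y) ∈? M) λ m → W≢Y (trans (sym cy) (proj₂ (∈M⇒Y-ends m)))
      by-colours : ∀ a b → c x ≡ a → c y ≡ b → d x + d y ≡ 1 + 𝟙 ((x , y) ∈? M)
      by-colours W W cx cy = ⊥-elim (noWW x y (inj₁ f∈) cx cy)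
      by-colours Y Y cx cy = cong₂ _+_ (dY cx) (trans (dY cy) (sym (𝟙-yes ((x , y) ∈? M) (∈-filter⁺ Y-ends? f∈ (cx , cy)))))
      by-colours Y W cx cy = trans (cong₂ _+_ (dY cx) (dW cy)) (cong (1 +_) (sym (not-in (inj₂ cy))))
      by-colours W Y cx cy = trans (cong₂ _+_ (dW cx) (dY cy)) (cong (1 +_) (sym (not-in (inj₁ cx))))

module _ {A : Set} where

  firstEdge lastEdge : A → List A → A → A × A
  firstEdge a []      b = a , b
  firstEdge a (x ∷ _) b = a , x
  lastEdge a []       b = a , b
  lastEdge a (x ∷ xs) b = lastEdge x xs b

  record Fresh (a : A) (xs : List A) (b : A) : Set where
    field
      first∉   : a ∉ xs
      last∉    : b ∉ xs
      first≢last : a ≢ b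
      interior-unique : Unique xs

  open Fresh public

  Fresh-tail : ∀ {a x : A} {xs b} → Fresh a (x ∷ xs) b → Fresh x xs b
  Fresh-tail fr with interior-unique fr
  ... | x∉ ∷ u = record
    { first∉ = λ x∈ → All.lookup x∉ x∈ refl
    ; last∉ = λ b∈ → last∉ fr (there b∈)
    ; first≢last = λ x≡b → last∉ fr (here (sym x≡b))
    ; interior-unique = u }

  pathEdges-ends : ∀ (a : A) xs b {e} → e ∈ pathEdges a xs b →
    ((proj₁ e ≡ a) ⊎ (proj₁ e ∈ xs)) × ((proj₂ e ∈ xs) ⊎ (proj₂ e ≡ b))
  pathEdges-ends a []       b (here refl) = inj₁ refl , inj₂ refl
  pathEdges-ends a (x ∷ xs) b (here refl) = inj₁ refl , inj₁ (here refl)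
  pathEdges-ends a (x ∷ xs) b (there e∈) with pathEdges-ends x xs b e∈
  ... | start , end = widen₁ start , widen₂ end
    where
    widen₁ : ∀ {z} → (z ≡ x) ⊎ (z ∈ xs) → (z ≡ a) ⊎ (z ∈ x ∷ xs)
    widen₁ (inj₁ eq) = inj₂ (here eq)
    widen₁ (inj₂ m)  = inj₂ (there m)
    widen₂ : ∀ {z} → (z ∈ xs) ⊎ (z ≡ b) → (z ∈ x ∷ xs) ⊎ (z ≡ b)
    widen₂ (inj₁ m)  = inj₁ (there m)
    widen₂ (inj₂ eq) = inj₂ eq

  map-proj₁-pathEdges : ∀ (a : A) xs b → map proj₁ (pathEdges a xs b) ≡ a ∷ xs
  map-proj₁-pathEdges a []       b = refl
  map-proj₁-pathEdges a (x ∷ xs) b = cong (a ∷_) (map-proj₁-pathEdges x xs b)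

  length-pathEdges : ∀ (a : A) xs b → length (pathEdges a xs b) ≡ suc (length xs)
  length-pathEdges a []       b = refl
  length-pathEdges a (x ∷ xs) b = cong suc (length-pathEdges x xs b)

  pathEdges-loopless : ∀ {a : A} {xs b} → Fresh a xs b → ∀ {e} → e ∈ pathEdges a xs b → proj₁ e ≢ proj₂ e
  pathEdges-loopless {xs = []}    fr (here refl) = first≢last fr
  pathEdges-loopless {xs = _ ∷ _} fr (here refl) eq = first∉ fr (here eq)
  pathEdges-loopless {xs = _ ∷ _} fr (there e∈) = pathEdges-loopless (Fresh-tail fr) e∈

  pathEdges-antisymmetric : ∀ {a : A} {xs b} → Fresh a xs b → ∀ {e} → e ∈ pathEdges a xs b → swap e ∉ pathEdges a xs b
  pathEdges-antisymmetric {xs = []} fr (here refl) (here eq) = first≢last fr (cong proj₁ (sym eq))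
  pathEdges-antisymmetric {xs = _ ∷ _} fr (here refl) (here eq) = first∉ fr (here (cong proj₁ (sym eq)))
  pathEdges-antisymmetric {a} {x ∷ xs} {b} fr (here refl) (there s∈) =
    a∉ (proj₂ (pathEdges-ends x xs b s∈))
    where
    a∉ : (a ∈ xs) ⊎ (a ≡ b) → ⊥
    a∉ (inj₁ a∈)  = first∉ fr (there a∈)
    a∉ (inj₂ a≡b) = first≢last fr a≡b
  pathEdges-antisymmetric {a} {x ∷ xs} {b} fr {e} (there e∈) (here eq) =
    a∉ (proj₂ (pathEdges-ends x xs b e∈))
    where
    a∉ : (proj₂ e ∈ xs) ⊎ (proj₂ e ≡ b) → ⊥
    a∉ (inj₁ m)   = first∉ fr (subst (_∈ x ∷ xs) (cong proj₁ eq) (there m))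
    a∉ (inj₂ e≡b) = first≢last fr (trans (sym (cong proj₁ eq)) e≡b)
  pathEdges-antisymmetric {xs = _ ∷ _} fr (there e∈) (there s∈) = pathEdges-antisymmetric (Fresh-tail fr) e∈ s∈

  pathEdges-unique : ∀ {a : A} {xs b} → Fresh a xs b → Unique (pathEdges a xs b)
  pathEdges-unique {a} {xs} {b} fr =
    map⁻ (subst Unique (sym (map-proj₁-pathEdges a xs b))
           (All.tabulate (λ x∈ a≡x → first∉ fr (subst (_∈ xs) (sym a≡x) x∈)) ∷ interior-unique fr))

  pathEdges-meets-interior : ∀ (a : A) xs b {z e} → z ∈ xs → e ∈ pathEdges a xs b →
    (proj₁ e ∈ xs) ⊎ (proj₂ e ∈ xs)
  pathEdges-meets-interior a (x ∷ xs) b _ (here refl) = inj₂ (here refl)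
  pathEdges-meets-interior a (x ∷ xs) b _ (there e∈) with pathEdges-ends x xs b e∈
  ... | inj₁ eq , _ = inj₁ (here eq)
  ... | inj₂ m  , _ = inj₁ (there m)

pathEdges-incident : ∀ {N} (a : Fin N) xs b {e z} → e ∈ pathEdges a xs b → Incident z e → (z ≡ a) ⊎ (z ∈ xs) ⊎ (z ≡ b)
pathEdges-incident a xs b e∈ z∈e with pathEdges-ends a xs b e∈ | z∈e
... | inj₁ eq , _ | inj₁ refl = inj₁ eq
... | inj₂ m  , _ | inj₁ refl = inj₂ (inj₁ m)
... | _ , inj₁ m  | inj₂ refl = inj₂ (inj₁ m)
... | _ , inj₂ eq | inj₂ refl = inj₂ (inj₂ eq)

ones : List Bool → ℕ
ones []       = 0
ones (b ∷ bs) = bit b + ones bs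

firstOf lastOf : List Bool → Bool
firstOf []      = false
firstOf (b ∷ _) = b
lastOf []           = false
lastOf (b ∷ [])     = b
lastOf (_ ∷ c ∷ bs) = lastOf (c ∷ bs)

firstBitOr : List Bool → ℕ → ℕ
firstBitOr []      β = β
firstBitOr (c ∷ _) β = bit c

-- bs marks the edges of a path that lie in P and α, β are the P-degrees of its end vertices.  The word
-- is perfect when every edge outside P sees total P-degree 1 at its endpoints, an interior vertex
-- having as P-degree the number of its two path edges in P.
PerfectWord : ℕ → List Bool → ℕ → Set
PerfectWord α []       β = ⊤
PerfectWord α (b ∷ bs) β = (b ≡ false → α + firstBitOr bs β ≡ 1) × PerfectWord (bit b) bs β

module AlongPath {N : ℕ} (P : List (Edge N)) where

  inP : Edge N → Bool
  inP e = does (e ∈? P)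

  inP-false⇒∉ : ∀ {e} → inP e ≡ false → e ∉ P
  inP-false⇒∉ {e} eq e∈ with trans (sym (dec-true (e ∈? P) e∈)) eq
  ... | ()

  ∉⇒inP-false : ∀ {e} → e ∉ P → inP e ≡ false
  ∉⇒inP-false {e} = dec-false (e ∈? P)

  localDegree : Fin N → List (Edge N) → ℕ
  localDegree z es = count (λ e → (e ∈? P) ×-dec incident? z e) es

  localDegree-off : ∀ a xs b {z} → z ≢ a → z ∉ xs → z ≢ b → localDegree z (pathEdges a xs b) ≡ 0
  localDegree-off a xs b z≢a z∉ z≢b =
    count≡0 _ (pathEdges a xs b) λ e e∈ (_ , z∈e) → off (pathEdges-incident a xs b e∈ z∈e)
    where
    off : _ → ⊥
    off (inj₁ eq)        = z≢a eq
    off (inj₂ (inj₁ m))  = z∉ m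
    off (inj₂ (inj₂ eq)) = z≢b eq

  localDegree-first : ∀ a xs b → a ∉ xs → a ≢ b → localDegree a (pathEdges a xs b) ≡ 𝟙 (firstEdge a xs b ∈? P)
  localDegree-first a []       b a∉ a≢b = trans (+-identityʳ _) (𝟙-×-yes ((a , b) ∈? P) (incident? a (a , b)) (inj₁ refl))
  localDegree-first a (x ∷ xs) b a∉ a≢b =
    trans (cong₂ _+_ (𝟙-×-yes ((a , x) ∈? P) (incident? a (a , x)) (inj₁ refl))
                     (localDegree-off x xs b (λ eq → a∉ (here eq)) (λ m → a∉ (there m)) a≢b))
          (+-identityʳ _)

  localDegree-last : ∀ a xs b → b ≢ a → b ∉ xs → localDegree b (pathEdges a xs b) ≡ 𝟙 (lastEdge a xs b ∈? P)
  localDegree-last a []       b b≢a b∉ = trans (+-identityʳ _) (𝟙-×-yes ((a , b) ∈? P) (incident? b (a , b)) (inj₂ refl))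
  localDegree-last a (x ∷ xs) b b≢a b∉ =
    cong₂ _+_ (𝟙-×-no ((a , x) ∈? P) (incident? b (a , x))
                λ { (inj₁ eq) → b≢a (sym eq) ; (inj₂ eq) → b∉ (here (sym eq)) })
              (localDegree-last x xs b (λ eq → b∉ (here eq)) (λ m → b∉ (there m)))

  InteriorDegrees : (Fin N → ℕ) → Fin N → List (Fin N) → Fin N → Set
  InteriorDegrees d a []       b = ⊤
  InteriorDegrees d a (x ∷ xs) b = (d x ≡ bit (inP (a , x)) + bit (inP (firstEdge x xs b))) × InteriorDegrees d x xs b

  interiorDegrees : ∀ (d : Fin N → ℕ) a xs b → Fresh a xs b →
    (∀ {y} → y ∈ xs → d y ≡ localDegree y (pathEdges a xs b)) → InteriorDegrees d a xs b
  interiorDegrees d a []       b fr local = tt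
  interiorDegrees d a (x ∷ xs) b fr local =
    trans (local (here refl))
          (cong₂ _+_ (𝟙-×-yes ((a , x) ∈? P) (incident? x (a , x)) (inj₂ refl))
                     (localDegree-first x xs b (first∉ fr′) (first≢last fr′))) ,
    interiorDegrees d x xs b fr′ λ {y} y∈ →
      trans (local (there y∈)) (cong (_+ localDegree y (pathEdges x xs b))
        (𝟙-×-no ((a , x) ∈? P) (incident? y (a , x))
          λ { (inj₁ eq) → first∉ fr (subst (_∈ x ∷ xs) (sym eq) (there y∈))
            ; (inj₂ eq) → first∉ fr′ (subst (_∈ xs) (sym eq) y∈) }))
    where
    fr′ = Fresh-tail fr

  firstOf-pathEdges : ∀ a ys b → bit (firstOf (map inP (pathEdges a ys b))) ≡ 𝟙 (firstEdge a ys b ∈? P)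
  firstOf-pathEdges a []      b = refl
  firstOf-pathEdges a (_ ∷ _) b = refl

  lastOf-pathEdges : ∀ a ys b → bit (lastOf (map inP (pathEdges a ys b))) ≡ 𝟙 (lastEdge a ys b ∈? P)
  lastOf-pathEdges a []           b = refl
  lastOf-pathEdges a (y ∷ [])     b = refl
  lastOf-pathEdges a (y ∷ z ∷ ys) b = lastOf-pathEdges y (z ∷ ys) b

  ones-map-inP : ∀ es → ones (map inP es) ≡ count (λ e → (e ∈? P) ×-dec yes tt) es
  ones-map-inP []       = refl
  ones-map-inP (e ∷ es) = cong₂ _+_ (sym (𝟙-×-yes (e ∈? P) (yes tt) tt)) (ones-map-inP es)

  firstBitOr-pathEdges : ∀ x xs b β → firstBitOr (map inP (pathEdges x xs b)) β ≡ bit (inP (firstEdge x xs b))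
  firstBitOr-pathEdges x []      b β = refl
  firstBitOr-pathEdges x (_ ∷ _) b β = refl

  module _ (d : Fin N → ℕ) where

    EdgesOutsideBalanced : List (Edge N) → Set
    EdgesOutsideBalanced es = ∀ {e} → e ∈ es → inP e ≡ false → d (proj₁ e) + d (proj₂ e) ≡ 1

    private
      interior-first : ∀ {a x xs b} → InteriorDegrees d a (x ∷ xs) b →
        inP (firstEdge x xs b) ≡ false → d x ≡ bit (inP (a , x))
      interior-first (dx , _) eq = trans dx (trans (cong (λ c → _ + bit c) eq) (+-identityʳ _))

      interior-after-gap : ∀ {a x xs b} → InteriorDegrees d a (x ∷ xs) b →
        inP (a , x) ≡ false → d x ≡ firstBitOr (map inP (pathEdges x xs b)) 0
      interior-after-gap {a} {x} {xs} {b} (dx , _) eq =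
        trans dx (trans (cong (λ c → bit c + _) eq) (sym (firstBitOr-pathEdges x xs b 0)))

    balanced⇒PerfectWord : ∀ a xs b {α β} → InteriorDegrees d a xs b →
      (inP (firstEdge a xs b) ≡ false → d a ≡ α) → d b ≡ β →
      EdgesOutsideBalanced (pathEdges a xs b) → PerfectWord α (map inP (pathEdges a xs b)) β
    balanced⇒PerfectWord a [] b _ da db bal =
      (λ out → trans (cong₂ _+_ (sym (da out)) (sym db)) (bal (here refl) out)) , tt
    balanced⇒PerfectWord a (x ∷ xs) b {α} {β} int da db bal =
      (λ out → trans (cong₂ _+_ (sym (da out)) (trans (firstBitOr-pathEdges x xs b β)
                                                       (sym (trans (interior-after-gap int out) (firstBitOr-pathEdges x xs b 0)))))
                     (bal (here refl) out)) ,
      balanced⇒PerfectWord x xs b (proj₂ int) (interior-first int) db (λ e∈ → bal (there e∈))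

    PerfectWord⇒balanced : ∀ a xs b {α β} → InteriorDegrees d a xs b →
      (inP (firstEdge a xs b) ≡ false → d a ≡ α) → d b ≡ β →
      PerfectWord α (map inP (pathEdges a xs b)) β → EdgesOutsideBalanced (pathEdges a xs b)
    PerfectWord⇒balanced a [] b _ da db (w , _) (here refl) out =
      trans (cong₂ _+_ (da out) db) (w out)
    PerfectWord⇒balanced a (x ∷ xs) b {α} {β} int da db (w , _) (here refl) out =
      trans (cong₂ _+_ (da out) (trans (interior-after-gap int out)
                                       (trans (firstBitOr-pathEdges x xs b 0) (sym (firstBitOr-pathEdges x xs b β)))))
            (w out)
    PerfectWord⇒balanced a (x ∷ xs) b int da db (_ , ws) (there e∈) out =
      PerfectWord⇒balanced x xs b (proj₂ int) (interior-first int) db ws e∈ out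

lookup-injective : ∀ {A : Set} {xs : List A} → Unique xs → ∀ {i j} → lookup xs i ≡ lookup xs j → i ≡ j
lookup-injective {xs = _ ∷ _} _ {zero} {zero} _ = refl
lookup-injective {xs = _ ∷ _} (x∉ ∷ _) {zero} {suc j} eq = ⊥-elim (All.lookup x∉ (∈-lookup j) eq)
lookup-injective {xs = _ ∷ _} (x∉ ∷ _) {suc i} {zero} eq = ⊥-elim (All.lookup x∉ (∈-lookup i) (sym eq))
lookup-injective {xs = _ ∷ _} (_ ∷ u) {suc i} {suc j} eq = cong suc (lookup-injective u eq)

module _ {A : Set} {L : ℕ} (g : Fin L → List A) where

  ∈-concatMap-allFin⁻ : ∀ {x} → x ∈ concatMap g (allFin L) → Σ (Fin L) λ i → x ∈ g i
  ∈-concatMap-allFin⁻ x∈ = satisfied (∈-concatMap⁻ g {xs = allFin L} x∈)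

  ∈-concatMap-allFin⁺ : ∀ {x} i → x ∈ g i → x ∈ concatMap g (allFin L)
  ∈-concatMap-allFin⁺ i x∈ = ∈-concatMap⁺ g (lose (∈-allFin i) x∈)

  concatMap-allFin-unique : (∀ i → Unique (g i)) → (∀ {i j} → i ≢ j → Disjoint (g i) (g j)) →
    Unique (concatMap g (allFin L))
  concatMap-allFin-unique unique disjoint = concat⁺
    (subst (All Unique) (sym (map-tabulate (λ i → i) g)) (All-tabulate⁺ unique))
    (subst (AllPairs Disjoint) (sym (map-tabulate (λ i → i) g)) (AllPairs.tabulate⁺ disjoint))

module EdgeIndexing {n : ℕ} (G : Graph n) where

  L = length (edges G)

  src tgt : Fin L → Fin n
  src i = proj₁ (lookup (edges G) i)
  tgt i = proj₂ (lookup (edges G) i)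

  lookup∈edges : ∀ i → (src i , tgt i) ∈ edges G
  lookup∈edges i = ∈-lookup i

  src≢tgt : ∀ i → src i ≢ tgt i
  src≢tgt i = edges-loopless G (lookup∈edges i)

  IndexJoins : Fin L → Fin n → Fin n → Set
  IndexJoins i = Joins (src i , tgt i)

  Adjacent⇒index : ∀ {u v} → Adjacent G u v → Σ (Fin L) λ i → IndexJoins i u v
  Adjacent⇒index (inj₁ uv∈) = index uv∈ , inj₁ (sym (lookup-index uv∈))
  Adjacent⇒index (inj₂ vu∈) = index vu∈ , inj₂ (sym (lookup-index vu∈))

  index⇒Adjacent : ∀ {i u v} → IndexJoins i u v → Adjacent G u v
  index⇒Adjacent {i} = Joins⇒Adjacent G (lookup∈edges i)

  IndexJoins-other : ∀ {i v u u′} → IndexJoins i v u → IndexJoins i v u′ → u′ ≡ u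
  IndexJoins-other {i} = Joins-other (edges-loopless G) (lookup∈edges i)

  IndexJoins-unique : ∀ {i j v u} → IndexJoins i v u → IndexJoins j v u → i ≡ j
  IndexJoins-unique {i} {j} ji jj = lookup-injective (edges-unique G)
    (Joins-unique (edges-loopless G) (edges-antisymmetric G) (lookup∈edges i) (lookup∈edges j) ji jj)

  IndexJoins-both : ∀ {i u v} (Q : Fin n → Set) → IndexJoins i u v → Q u → Q v → Q (src i) × Q (tgt i)
  IndexJoins-both Q (inj₁ refl) qu qv = qu , qv
  IndexJoins-both Q (inj₂ refl) qu qv = qv , qu

  ends : Fin n → Fin L → ℕ
  ends v i = 𝟙 (src i ≟ᶠ v) + 𝟙 (tgt i ≟ᶠ v)

  IndexJoins⇒ends≡1 : ∀ {i v u} → IndexJoins i v u → ends v i ≡ 1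
  IndexJoins⇒ends≡1 {i} (inj₁ refl) =
    cong₂ _+_ (𝟙-yes (src i ≟ᶠ src i) refl) (𝟙-no (tgt i ≟ᶠ src i) (λ eq → src≢tgt i (sym eq)))
  IndexJoins⇒ends≡1 {i} (inj₂ refl) =
    cong₂ _+_ (𝟙-no (src i ≟ᶠ tgt i) (src≢tgt i)) (𝟙-yes (tgt i ≟ᶠ tgt i) refl)

  ends≥1⇒IndexJoins : ∀ {i v} → 1 ≤ ends v i → Σ (Fin n) (IndexJoins i v)
  ends≥1⇒IndexJoins {i} {v} h with src i ≟ᶠ v | tgt i ≟ᶠ v
  ... | yes refl | _        = tgt i , inj₁ refl
  ... | no _     | yes refl = src i , inj₂ refl

  degree≡∑ends : ∀ v → degree G v ≡ ∑[ i < L ] ends v i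
  degree≡∑ends v = begin
    length (filter (incident? v) (edges G))                   ≡⟨ length-filter (incident? v) (edges G) ⟩
    count (incident? v) (edges G)                             ≡⟨ cong (count (incident? v)) (tabulate-lookup (edges G)) ⟨
    count (incident? v) (tabulate (lookup (edges G)))         ≡⟨ count-tabulate (incident? v) L (lookup (edges G)) ⟩
    ∑[ i < L ] 𝟙 (incident? v (lookup (edges G) i))           ≡⟨ sum-cong-≗ term ⟩
    ∑[ i < L ] ends v i                                       ∎
    where
    open ≡-Reasoning
    term : ∀ i → 𝟙 (incident? v (lookup (edges G) i)) ≡ ends v i
    term i with src i ≟ᶠ v | tgt i ≟ᶠ v
    ... | yes s≡v | yes t≡v = ⊥-elim (src≢tgt i (trans s≡v (sym t≡v)))
    ... | yes _   | no _    = refl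
    ... | no _    | yes _   = refl
    ... | no _    | no _    = refl

  Adjacent⇒degree≥1 : ∀ {u v} → Adjacent G u v → 1 ≤ degree G u
  Adjacent⇒degree≥1 {u} adj = let i , j = Adjacent⇒index adj in
    ≤-trans (≤-reflexive (sym (IndexJoins⇒ends≡1 j))) (≤-trans (≤∑ L (ends u) i) (≤-reflexive (sym (degree≡∑ends u))))

  regular-0-colouring : Regular 0 G → Σ (Fin n → Colour) (ColouringII G)
  regular-0-colouring regular =
    (λ _ → W) , (λ u v adj _ _ → 1+n≰n (≤-trans (Adjacent⇒degree≥1 adj) (≤-reflexive (regular u)))) , (λ _ ())

  regular-1-colouring : Regular 1 G → Σ (Fin n → Colour) (ColouringII G)
  regular-1-colouring regular = (λ _ → Y) , (λ _ _ _ ()) , λ v _ →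
    let ∑ends≡1 = trans (sym (degree≡∑ends v)) (regular v)
        i , t = ∑≥1⇒∃ L (ends v) (≤-reflexive (sym ∑ends≡1))
        u , j = ends≥1⇒IndexJoins t
    in u , index⇒Adjacent j , refl , λ u′ adj _ →
         let i′ , j′ = Adjacent⇒index adj
         in IndexJoins-other j (subst (λ x → IndexJoins x v u′)
              (sym (∑≤1⇒unique L (ends v) (≤-reflexive ∑ends≡1) i i′ t
                     (≤-reflexive (sym (IndexJoins⇒ends≡1 j′))))) j′)

  handshake : ∀ (g h : Fin L → Fin n → ℕ) →
    ∑[ v < n ] ∑[ i < L ] (𝟙 (src i ≟ᶠ v) * g i v + 𝟙 (tgt i ≟ᶠ v) * h i v) ≡ ∑[ i < L ] (g i (src i) + h i (tgt i))
  handshake g h = trans (∑-comm {n} {L} _) (sum-cong-≗ λ i →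
    trans (∑-distrib-+ (λ v → 𝟙 (src i ≟ᶠ v) * g i v) (λ v → 𝟙 (tgt i ≟ᶠ v) * h i v))
          (cong₂ _+_ (∑-pick n (src i) (g i)) (∑-pick n (tgt i) (h i))))

zero⊎Fin : ∀ m → (m ≡ 0) ⊎ Fin m
zero⊎Fin zero    = inj₁ refl
zero⊎Fin (suc _) = inj₂ zero

module Subdivision {n : ℕ} (G : Graph n) (m : ℕ) where

  open EdgeIndexing G public using (L; src; tgt; lookup∈edges; src≢tgt)

  N = subdivVertices m G

  old : Fin n → Fin N
  old v = v ↑ˡ (L * m)

  new : Fin L → Fin m → Fin N
  new i j = n ↑ʳ combine i j

  interior : Fin L → List (Fin N)
  interior i = map (new i) (allFin m)

  path : Fin L → List (Edge N)
  path i = pathEdges (old (src i)) (interior i) (old (tgt i))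

  E : List (Edge N)
  E = subdivEdges m G

  ∈E⁻ : ∀ {e} → e ∈ E → Σ (Fin L) λ i → e ∈ path i
  ∈E⁻ = ∈-concatMap-allFin⁻ path

  ∈E⁺ : ∀ {e} i → e ∈ path i → e ∈ E
  ∈E⁺ = ∈-concatMap-allFin⁺ path

  old-injective : ∀ {u v} → old u ≡ old v → u ≡ v
  old-injective = ↑ˡ-injective (L * m) _ _

  old≢new : ∀ v i j → old v ≢ new i j
  old≢new v i j eq with trans (sym (splitAt-↑ˡ n v (L * m))) (trans (cong (splitAt n) eq) (splitAt-↑ʳ n (L * m) (combine i j)))
  ... | ()

  new-injective : ∀ {i j i′ j′} → new i j ≡ new i′ j′ → (i ≡ i′) × (j ≡ j′)
  new-injective eq = combine-injective _ _ _ _ (↑ʳ-injective n _ _ eq)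

  ∈interior⁻ : ∀ {i z} → z ∈ interior i → Σ (Fin m) λ j → z ≡ new i j
  ∈interior⁻ {i} z∈ with ∈-map⁻ (new i) z∈
  ... | j , _ , eq = j , eq

  old∉interior : ∀ v i → old v ∉ interior i
  old∉interior v i z∈ with ∈interior⁻ z∈
  ... | j , eq = old≢new v i j eq

  new∉interior : ∀ {i j i′} → i ≢ i′ → new i j ∉ interior i′
  new∉interior i≢i′ z∈ with ∈interior⁻ z∈
  ... | _ , eq = i≢i′ (proj₁ (new-injective eq))

  path-fresh : ∀ i → Fresh (old (src i)) (interior i) (old (tgt i))
  path-fresh i = record
    { first∉ = old∉interior (src i) i
    ; last∉ = old∉interior (tgt i) i
    ; first≢last = λ eq → src≢tgt i (old-injective eq)
    ; interior-unique = map⁺ (λ eq → proj₂ (new-injective eq)) (allFin⁺ m) }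

  path-incident : ∀ j {e z} → e ∈ path j → Incident z e →
    (z ≡ old (src j)) ⊎ (z ∈ interior j) ⊎ (z ≡ old (tgt j))
  path-incident j = pathEdges-incident (old (src j)) (interior j) (old (tgt j))

  path-meets-interior : Fin m → ∀ i {e} → e ∈ path i → Σ (Fin m) λ j → Incident (new i j) e
  path-meets-interior j₀ i e∈
    with pathEdges-meets-interior (old (src i)) (interior i) (old (tgt i)) (∈-map⁺ (new i) (∈-allFin j₀)) e∈
  ... | inj₁ z∈ = let j , z≡ = ∈interior⁻ z∈ in j , inj₁ z≡
  ... | inj₂ z∈ = let j , z≡ = ∈interior⁻ z∈ in j , inj₂ z≡

  interior-empty : m ≡ 0 → ∀ i → interior i ≡ []
  interior-empty m≡0 i = length≡0 (trans (length-map (new i) (allFin m)) (trans (length-tabulate (λ j → j)) m≡0))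
    where
    length≡0 : ∀ {xs : List (Fin N)} → length xs ≡ 0 → xs ≡ []
    length≡0 {[]} _ = refl

  path-without-interior : m ≡ 0 → ∀ i {e} → e ∈ path i → e ≡ (old (src i) , old (tgt i))
  path-without-interior m≡0 i e∈ with interior i | interior-empty m≡0 i
  path-without-interior m≡0 i (here refl) | .[] | refl = refl

  has-interior? : (m ≡ 0) ⊎ Fin m
  has-interior? = zero⊎Fin m

  swap-Incident : ∀ {z} (e : Edge N) → Incident z e → Incident z (swap e)
  swap-Incident e (inj₁ eq) = inj₂ eq
  swap-Incident e (inj₂ eq) = inj₁ eq

  new-endpoint⇒same-path : ∀ {i j e k} → Incident (new i j) e → e ∈ path k → i ≡ k
  new-endpoint⇒same-path {i} {j} {k = k} inc e∈k with path-incident k e∈k inc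
  ... | inj₁ eq        = ⊥-elim (old≢new (src k) i j (sym eq))
  ... | inj₂ (inj₂ eq) = ⊥-elim (old≢new (tgt k) i j (sym eq))
  ... | inj₂ (inj₁ z∈) with i ≟ᶠ k
  ...   | yes i≡k = i≡k
  ...   | no  i≢k = ⊥-elim (new∉interior i≢k z∈)

  paths-disjoint : ∀ {i k} → i ≢ k → Disjoint (path i) (path k)
  paths-disjoint {i} {k} i≢k (e∈i , e∈k) with has-interior?
  ... | inj₁ m≡0 =
    i≢k (lookup-injective (edges-unique G) (cong₂ _,_ (old-injective (cong proj₁ same)) (old-injective (cong proj₂ same))))
    where same = trans (sym (path-without-interior m≡0 i e∈i)) (path-without-interior m≡0 k e∈k)
  ... | inj₂ j₀ with path-meets-interior j₀ i e∈i
  ...   | j , inc = i≢k (new-endpoint⇒same-path inc e∈k)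

  E-unique : Unique E
  E-unique = concatMap-allFin-unique path (λ i → pathEdges-unique (path-fresh i)) paths-disjoint

  E-loopless : Loopless E
  E-loopless f∈ with ∈E⁻ f∈
  ... | i , f∈i = pathEdges-loopless (path-fresh i) f∈i

  E-antisymmetric : Antisymmetric E
  E-antisymmetric {f} f∈ s∈ with ∈E⁻ f∈ | ∈E⁻ s∈ | has-interior?
  ... | i , f∈i | k , s∈k | inj₁ m≡0 =
    edges-antisymmetric G (lookup∈edges i)
      (subst (_∈ edges G) (cong₂ _,_ (old-injective (cong proj₁ flip)) (old-injective (cong proj₂ flip))) (lookup∈edges k))
    where flip = trans (sym (path-without-interior m≡0 k s∈k)) (cong swap (path-without-interior m≡0 i f∈i))
  ... | i , f∈i | k , s∈k | inj₂ j₀ with path-meets-interior j₀ i f∈i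
  ...   | j , inc with new-endpoint⇒same-path (swap-Incident f inc) s∈k
  ...     | refl = pathEdges-antisymmetric (path-fresh i) f∈i s∈k

module SubdivisionSubset {n : ℕ} (G : Graph n) (m : ℕ)
  {P : List (Edge (subdivVertices m G))} (P⊆E : EdgeSubset (Subdivision.E G m) P) where

  open Subdivision G m public
  open AlongPath P public

  d : Fin N → ℕ
  d = degreeIn P

  D : Fin n → ℕ
  D v = d (old v)

  bits : Fin L → List Bool
  bits i = map inP (path i)

  firstIn lastIn : Fin L → Bool
  firstIn i = firstOf (bits i)
  lastIn i = lastOf (bits i)

  count≡∑paths : ∀ {Q : Pred (Edge N) _} (Q? : Decidable Q) →
    count Q? P ≡ ∑[ i < L ] count (λ e → (e ∈? P) ×-dec Q? e) (path i)
  count≡∑paths Q? = trans (count-sublist _≟ₑ_ Q? (proj₁ P⊆E) (proj₂ P⊆E) E-unique) (count-concatMap _ L path)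

  selectedAt : Fin n → Fin L → ℕ
  selectedAt v i = 𝟙 (src i ≟ᶠ v) * bit (firstIn i) + 𝟙 (tgt i ≟ᶠ v) * bit (lastIn i)

  localDegree-old : ∀ v i → localDegree (old v) (path i) ≡ selectedAt v i
  localDegree-old v i with src i ≟ᶠ v | tgt i ≟ᶠ v
  ... | yes refl | yes t≡s = ⊥-elim (src≢tgt i (sym t≡s))
  ... | yes refl | no _ =
    trans (localDegree-first (old (src i)) (interior i) (old (tgt i)) (first∉ fr) (first≢last fr))
          (sym (trans (+-identityʳ _) (trans (+-identityʳ _) (firstOf-pathEdges (old (src i)) (interior i) (old (tgt i))))))
    where fr = path-fresh i
  ... | no _ | yes refl =
    trans (localDegree-last (old (src i)) (interior i) (old (tgt i)) (λ eq → first≢last fr (sym eq)) (last∉ fr))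
          (sym (trans (+-identityʳ _) (lastOf-pathEdges (old (src i)) (interior i) (old (tgt i)))))
    where fr = path-fresh i
  ... | no s≢v | no t≢v =
    localDegree-off (old (src i)) (interior i) (old (tgt i))
      (λ eq → s≢v (sym (old-injective eq))) (old∉interior v i) (λ eq → t≢v (sym (old-injective eq)))

  D≡∑ : ∀ v → D v ≡ ∑[ i < L ] selectedAt v i
  D≡∑ v = trans (count≡∑paths (incident? (old v))) (sum-cong-≗ (localDegree-old v))

  selectedAt≥1⇒ : ∀ {v i} → 1 ≤ selectedAt v i →
    ((src i ≡ v) × (firstIn i ≡ true)) ⊎ ((tgt i ≡ v) × (lastIn i ≡ true))
  selectedAt≥1⇒ {v} {i} h with +≥1⇒ (𝟙 (src i ≟ᶠ v) * bit (firstIn i)) h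
  ... | inj₁ t = inj₁ (𝟙*bit≥1⇒ (src i ≟ᶠ v) (firstIn i) t)
  ... | inj₂ t = inj₂ (𝟙*bit≥1⇒ (tgt i ≟ᶠ v) (lastIn i) t)

  d-new≡localDegree : ∀ i j → d (new i j) ≡ localDegree (new i j) (path i)
  d-new≡localDegree i j = trans (count≡∑paths (incident? (new i j))) (∑-single L _ i λ k k≢i →
    localDegree-off (old (src k)) (interior k) (old (tgt k))
      (λ eq → old≢new (src k) i j (sym eq)) (new∉interior (λ i≡k → k≢i (sym i≡k)))
      (λ eq → old≢new (tgt k) i j (sym eq)))

  path-interiorDegrees : ∀ i → InteriorDegrees d (old (src i)) (interior i) (old (tgt i))
  path-interiorDegrees i = interiorDegrees d (old (src i)) (interior i) (old (tgt i)) (path-fresh i)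
    λ y∈ → let j , y≡ = ∈interior⁻ y∈ in subst (λ z → d z ≡ localDegree z (path i)) (sym y≡) (d-new≡localDegree i j)

  domCount-outside : ∀ {f} → f ∈ E → f ∉ P → domCount P f ≡ d (proj₁ f) + d (proj₂ f)
  domCount-outside {f} f∈ f∉ = trans (sym (trans (cong (domCount P f +_) (𝟙-no (f ∈? P) f∉)) (+-identityʳ _)))
    (domCount-formula E-loopless E-antisymmetric (proj₁ P⊆E) (proj₂ P⊆E) f∈)

  PerfectlyDominating : Set
  PerfectlyDominating = ∀ f → f ∈ E → f ∉ P → domCount P f ≡ 1

  perfect⇒PerfectWord : PerfectlyDominating → ∀ i → PerfectWord (D (src i)) (bits i) (D (tgt i))
  perfect⇒PerfectWord perfect i =
    balanced⇒PerfectWord d (old (src i)) (interior i) (old (tgt i)) (path-interiorDegrees i) (λ _ → refl) refl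
      λ e∈ out → let f∈ = ∈E⁺ i e∈ ; f∉ = inP-false⇒∉ out in
        trans (sym (domCount-outside f∈ f∉)) (perfect _ f∈ f∉)

  PerfectWord⇒perfect : (∀ i → PerfectWord (D (src i)) (bits i) (D (tgt i))) → PerfectlyDominating
  PerfectWord⇒perfect words f f∈ f∉ with ∈E⁻ f∈
  ... | i , f∈i = trans (domCount-outside f∈ f∉)
    (PerfectWord⇒balanced d (old (src i)) (interior i) (old (tgt i)) (path-interiorDegrees i) (λ _ → refl) refl (words i)
      f∈i (∉⇒inP-false f∉))

  length≡∑ones : length P ≡ ∑[ i < L ] ones (bits i)
  length≡∑ones = trans (length≡count P)
    (trans (count≡∑paths (λ _ → yes tt)) (sum-cong-≗ λ i → sym (ones-map-inP (path i))))
    where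
    length≡count : ∀ (es : List (Edge N)) → length es ≡ count (λ _ → yes tt) es
    length≡count []       = refl
    length≡count (e ∷ es) = cong suc (length≡count es)

  length-bits : ∀ i → length (bits i) ≡ suc m
  length-bits i = trans (length-map inP (path i)) (trans (length-pathEdges (old (src i)) (interior i) (old (tgt i)))
                    (cong suc (trans (length-map (new i) (allFin m)) (length-tabulate (λ j → j)))))

triple : ℕ → ℕ
triple zero    = 0
triple (suc k) = 3 + triple k

triple≡3* : ∀ k → triple k ≡ 3 * k
triple≡3* zero    = refl
triple≡3* (suc k) = trans (cong (3 +_) (triple≡3* k)) (sym (*-suc 3 k))

triple-cancel-≤ : ∀ k o c → c ≤ 2 → triple k ≤ c + triple o → k ≤ o
triple-cancel-≤ zero    o       c _   _ = z≤n
triple-cancel-≤ (suc k) zero    c c≤2 h = ⊥-elim (3+≰2 (≤-trans h (≤-trans (≤-reflexive (+-identityʳ c)) c≤2)))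
  where
  3+≰2 : ∀ {x} → 3 + x ≤ 2 → ⊥
  3+≰2 (s≤s (s≤s ()))
triple-cancel-≤ (suc k) (suc o) c c≤2 h =
  s≤s (triple-cancel-≤ k o c c≤2 (+-cancelˡ-≤ 3 _ _ (subst (3 + triple k ≤_) (shift c (triple o)) h)))
  where
  shift : ∀ c t → c + (3 + t) ≡ 3 + (c + t)
  shift = solve-∀

-- After a letter 1, a perfect word is a concatenation of blocks 1 and 001, followed by nothing,
-- by 0 (then β = 0) or by 00 (then β = 1).
perfect-after-1 : ∀ bs {β} → PerfectWord 1 bs β →
  (length bs ≤ 2 + triple (ones bs)) ×
  (1 + triple (ones bs) ≤ length bs → ∀ c → lastOf (c ∷ bs) ≡ false) ×
  (length bs ≡ 2 + triple (ones bs) → β ≡ 1)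
perfect-after-1 [] _ = z≤n , (λ ()) , (λ ())
perfect-after-1 (true ∷ rest) (_ , w) with perfect-after-1 rest w
... | short , _ , _ =
  ≤-trans (s≤s short) (m≤n+m _ 2) ,
  (λ { (s≤s long) _ → ⊥-elim (1+n≰n (≤-trans long short)) }) ,
  (λ eq → ⊥-elim (1+n≰n (≤-trans (n≤1+n _) (≤-trans (≤-reflexive (sym (suc-injective eq))) short))))
perfect-after-1 (false ∷ []) _ = s≤s z≤n , (λ _ _ → refl) , (λ ())
perfect-after-1 (false ∷ false ∷ []) (_ , β≡1 , _) = ≤-refl , (λ _ _ → refl) , (λ _ → β≡1 refl)
perfect-after-1 (false ∷ true ∷ _) (bad , _) with bad refl
... | ()
perfect-after-1 (false ∷ false ∷ false ∷ _) (_ , bad , _) with bad refl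
... | ()
perfect-after-1 (false ∷ false ∷ true ∷ rest) (_ , _ , _ , w) with perfect-after-1 rest w
... | short , ends-0 , β≡1 = s≤s (s≤s (s≤s short)) , (λ { (s≤s (s≤s (s≤s long))) _ → ends-0 long true }) ,
  (λ eq → β≡1 (suc-injective (suc-injective (suc-injective eq))))

+≡1⇒ : ∀ {α β} → α + β ≡ 1 → (α ≡ 1) ⊎ (β ≡ 1)
+≡1⇒ {zero}        eq = inj₂ eq
+≡1⇒ {suc zero}    _  = inj₁ refl

perfect-length-3k+1 : ∀ k bs {α β} → PerfectWord α bs β → length bs ≡ 1 + triple k →
  (k ≤ ones bs) × (ones bs ≡ k → (firstOf bs ≡ false) × (lastOf bs ≡ false) × ((α ≡ 1) ⊎ (β ≡ 1)))
perfect-length-3k+1 k (true ∷ rest) (_ , w) eq with perfect-after-1 rest w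
... | short , _ , _ = ≤-trans k≤o (n≤1+n _) , λ o≡k → ⊥-elim (1+n≰n (subst (_≤ ones rest) (sym o≡k) k≤o))
  where
  k≤o : k ≤ ones rest
  k≤o = triple-cancel-≤ k (ones rest) 2 ≤-refl (subst (_≤ 2 + triple (ones rest)) (suc-injective eq) short)
perfect-length-3k+1 zero    (false ∷ []) (w , _) _ = z≤n , λ _ → refl , refl , +≡1⇒ (w refl)
perfect-length-3k+1 zero    (false ∷ false ∷ []) _ ()
perfect-length-3k+1 (suc k) (false ∷ false ∷ []) _ ()
perfect-length-3k+1 k (false ∷ false ∷ false ∷ _) (_ , bad , _) _ with bad refl
... | ()
perfect-length-3k+1 k (false ∷ true ∷ rest) (_ , _ , w) eq with perfect-after-1 rest w
... | short , ends-0 , β≡1 =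
  triple-cancel-≤ k (suc (ones rest)) 0 z≤n (≤-trans (≤-reflexive (sym (suc-injective eq))) (s≤s short)) ,
  λ { refl → refl , ends-0 (≤-trans (n≤1+n _) (≤-reflexive (sym (tail-length refl)))) true , inj₂ (β≡1 (tail-length refl)) }
  where
  tail-length : suc (ones rest) ≡ k → length rest ≡ 2 + triple (ones rest)
  tail-length refl = suc-injective (suc-injective eq)
perfect-length-3k+1 k (false ∷ false ∷ true ∷ rest) {α} (α+0≡1 , _ , _ , w) eq with perfect-after-1 rest w
... | short , ends-0 , _ =
  triple-cancel-≤ k (suc (ones rest)) 1 (s≤s z≤n) (≤-trans (≤-reflexive (sym (suc-injective eq))) (s≤s (s≤s short))) ,
  λ { refl → refl , ends-0 (≤-reflexive (sym (tail-length refl))) true , inj₁ (trans (sym (+-identityʳ α)) (α+0≡1 refl)) }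
  where
  tail-length : suc (ones rest) ≡ k → length rest ≡ 1 + triple (ones rest)
  tail-length refl = suc-injective (suc-injective (suc-injective eq))

weight : ℕ → Bool → ℕ → ℕ
weight r true  α = r
weight r false α = 1 ∸ α

weight≤r : ∀ r b α → 1 ≤ r → weight r b α ≤ r
weight≤r r true  α _   = ≤-refl
weight≤r r false α r≥1 = ≤-trans (m∸n≤m 1 α) r≥1

2r≤[2r∸1]*suc+1 : ∀ r ε → 1 ≤ r → 2 * r ≤ (2 * r ∸ 1) * suc ε + 1
2r≤[2r∸1]*suc+1 r ε r≥1 = begin
  2 * r                    ≡⟨ m∸n+n≡m (≤-trans r≥1 (m≤m+n r (r + 0))) ⟨
  (2 * r ∸ 1) + 1          ≤⟨ +-monoˡ-≤ 1 (m≤m*n (2 * r ∸ 1) (suc ε)) ⟩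
  (2 * r ∸ 1) * suc ε + 1  ∎
  where open ≤-Reasoning

path-weight-bound : ∀ r k bs {α β} → 1 ≤ r → PerfectWord α bs β → length bs ≡ 1 + triple k →
  weight r (firstOf bs) α + weight r (lastOf bs) β ≤ (2 * r ∸ 1) * (ones bs ∸ k) + 1
path-weight-bound r k bs {α} {β} r≥1 w len with perfect-length-3k+1 k bs w len
... | k≤ones , exactly-k = bound (ones bs ∸ k) refl
  where
  bound : ∀ ε → ones bs ∸ k ≡ ε → weight r (firstOf bs) α + weight r (lastOf bs) β ≤ (2 * r ∸ 1) * ε + 1
  bound zero    ε≡0 with exactly-k (trans (sym (m∸n+n≡m k≤ones)) (cong (_+ k) ε≡0))
  ... | first-out , last-out , α⊎β rewrite first-out | last-out | *-zeroʳ (2 * r ∸ 1) = one-end α⊎β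
    where
    one-end : (α ≡ 1) ⊎ (β ≡ 1) → (1 ∸ α) + (1 ∸ β) ≤ 1
    one-end (inj₁ refl) = m∸n≤m 1 β
    one-end (inj₂ refl) = ≤-trans (≤-reflexive (+-identityʳ _)) (m∸n≤m 1 α)
  bound (suc ε) _ = begin
    weight r (firstOf bs) α + weight r (lastOf bs) β
      ≤⟨ +-mono-≤ (weight≤r r (firstOf bs) α r≥1) (weight≤r r (lastOf bs) β r≥1) ⟩
    r + r                                             ≡⟨ cong (r +_) (+-identityʳ r) ⟨
    2 * r                                             ≤⟨ 2r≤[2r∸1]*suc+1 r ε r≥1 ⟩
    (2 * r ∸ 1) * suc ε + 1                           ∎
    where open ≤-Reasoning

EndPattern : Bool → Bool → ℕ → ℕ → Set
EndPattern b₁ b₂ α β =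
  ((b₁ ≡ true) × (b₂ ≡ true)) ⊎
  ((b₁ ≡ false) × (b₂ ≡ false) × (((α ≡ 1) × (β ≡ 0)) ⊎ ((α ≡ 0) × (β ≡ 1))))

EndPattern-one-selected : ∀ {b₁ b₂ α β} → EndPattern b₁ b₂ α β →
  b₁ ≡ true ⊎ b₂ ≡ true → (b₁ ≡ true) × (b₂ ≡ true)
EndPattern-one-selected (inj₁ both) _ = both
EndPattern-one-selected (inj₂ (refl , _ , _)) (inj₁ ())
EndPattern-one-selected (inj₂ (_ , refl , _)) (inj₂ ())

EndPattern-equal-ends : ∀ {b₁ b₂ α β c} → EndPattern b₁ b₂ α β → (α ≡ c) × (β ≡ c) → (b₁ ≡ true) × (b₂ ≡ true)
EndPattern-equal-ends (inj₁ both) _ = both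
EndPattern-equal-ends (inj₂ (_ , _ , inj₁ (refl , refl))) (refl , ())
EndPattern-equal-ends (inj₂ (_ , _ , inj₂ (refl , refl))) (refl , ())

tight-with-selected-end : ∀ r ε {w} → 2 ≤ r → w ≤ 1 → (2 * r ∸ 1) * ε + 1 ≢ r + w
tight-with-selected-end r zero {w} r≥2 _ eq =
  <⇒≱ r≥2 (≤-trans (m≤m+n r w) (≤-reflexive (sym (trans (cong (_+ 1) (sym (*-zeroʳ (2 * r ∸ 1)))) eq))))
tight-with-selected-end r (suc ε) {w} r≥2 w≤1 eq = <⇒≱ r≥2 (≤-trans (+-cancelˡ-≤ r r w r+r≤r+w) w≤1)
  where
  r+r≤r+w : r + r ≤ r + w
  r+r≤r+w = begin
    r + r                    ≡⟨ cong (r +_) (+-identityʳ r) ⟨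
    2 * r                    ≤⟨ 2r≤[2r∸1]*suc+1 r ε (≤-trans (s≤s z≤n) r≥2) ⟩
    (2 * r ∸ 1) * suc ε + 1  ≡⟨ eq ⟩
    r + w                    ∎
    where open ≤-Reasoning

tight-weight⇒EndPattern : ∀ r ε b₁ b₂ {α β} → 2 ≤ r → α ≤ 1 → β ≤ 1 →
  (2 * r ∸ 1) * ε + 1 ≡ weight r b₁ α + weight r b₂ β → EndPattern b₁ b₂ α β
tight-weight⇒EndPattern r ε true  true  _ _ _ _ = inj₁ (refl , refl)
tight-weight⇒EndPattern r ε true  false {β = β} r≥2 _ _ eq = ⊥-elim (tight-with-selected-end r ε r≥2 (m∸n≤m 1 β) eq)
tight-weight⇒EndPattern r ε false true  {α} r≥2 _ _ eq =
  ⊥-elim (tight-with-selected-end r ε r≥2 (m∸n≤m 1 α) (trans eq (+-comm (1 ∸ α) r)))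
tight-weight⇒EndPattern r (suc ε) false false {α} {β} r≥2 _ _ eq =
  ⊥-elim (<⇒≱ r≥2 (*-cancelˡ-≤ 2 (≤-trans (2r≤[2r∸1]*suc+1 r ε (≤-trans (s≤s z≤n) r≥2))
                                   (≤-trans (≤-reflexive eq) (+-mono-≤ (m∸n≤m 1 α) (m∸n≤m 1 β))))))
tight-weight⇒EndPattern r zero false false {α} {β} _ α≤1 β≤1 eq =
  inj₂ (refl , refl , exactly-one α≤1 β≤1 (trans (sym eq) (cong (_+ 1) (*-zeroʳ (2 * r ∸ 1)))))
  where
  exactly-one : ∀ {α β} → α ≤ 1 → β ≤ 1 → (1 ∸ α) + (1 ∸ β) ≡ 1 →
    ((α ≡ 1) × (β ≡ 0)) ⊎ ((α ≡ 0) × (β ≡ 1))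
  exactly-one {0} {1} _ _ _ = inj₂ (refl , refl)
  exactly-one {1} {0} _ _ _ = inj₁ (refl , refl)
  exactly-one {0} {0} _ _ ()
  exactly-one {1} {1} _ _ ()
  exactly-one {suc (suc _)} (s≤s ()) _ _
  exactly-one {_} {suc (suc _)} _ (s≤s ()) _

PerfectWord-first-out : ∀ {α bs β} → PerfectWord α bs β → firstOf bs ≡ false → 1 ≤ length bs → α ≤ 1
PerfectWord-first-out {α} {false ∷ bs} (w , _) _ _ = ≤-trans (m≤m+n α _) (≤-reflexive (w refl))

PerfectWord-last-out : ∀ {α bs β} → PerfectWord α bs β → lastOf bs ≡ false → 1 ≤ length bs → β ≤ 1
PerfectWord-last-out {α} {_ ∷ []} {β} (w , _) out _ = ≤-trans (m≤n+m β α) (≤-reflexive (w out))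
PerfectWord-last-out {bs = _ ∷ _ ∷ _} (_ , ws) out _ = PerfectWord-last-out ws out (s≤s z≤n)

weight≡ : ∀ r b d → weight r b d ≡ r * bit b + (1 ∸ d) * (1 ∸ bit b)
weight≡ r true  d = trans (sym (*-identityʳ r)) (sym (trans (cong (r * 1 +_) (*-zeroʳ (1 ∸ d))) (+-identityʳ _)))
weight≡ r false d = trans (sym (*-identityʳ (1 ∸ d))) (cong (_+ (1 ∸ d) * 1) (sym (*-zeroʳ r)))

bit+[1∸bit] : ∀ b → bit b + (1 ∸ bit b) ≡ 1
bit+[1∸bit] true  = refl
bit+[1∸bit] false = refl

module PathWeights {n : ℕ} (r k : ℕ) (G : Graph n) (regular : Regular r G)
  {P : List (Edge (subdivVertices (3 * k) G))} (P⊆E : EdgeSubset (Subdivision.E G (3 * k)) P) where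

  open SubdivisionSubset G (3 * k) P⊆E public
  open EdgeIndexing G using (IndexJoins; ends; degree≡∑ends; handshake)

  ε : Fin L → ℕ
  ε i = ones (bits i) ∸ k

  pathWeight pathBound : Fin L → ℕ
  pathWeight i = weight r (firstIn i) (D (src i)) + weight r (lastIn i) (D (tgt i))
  pathBound i = (2 * r ∸ 1) * ε i + 1

  atEnds : Fin n → (Bool → ℕ) → ℕ
  atEnds v f = ∑[ i < L ] (𝟙 (src i ≟ᶠ v) * f (firstIn i) + 𝟙 (tgt i ≟ᶠ v) * f (lastIn i))

  vertexWeight unselectedEnds : Fin n → ℕ
  vertexWeight v = atEnds v (λ b → weight r b (D v))
  unselectedEnds v = atEnds v (λ b → 1 ∸ bit b)

  ∑vertexWeight≡∑pathWeight : ∑[ v < n ] vertexWeight v ≡ ∑[ i < L ] pathWeight i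
  ∑vertexWeight≡∑pathWeight = handshake (λ i v → weight r (firstIn i) (D v)) (λ i v → weight r (lastIn i) (D v))

  vertexWeight≡ : ∀ v → vertexWeight v ≡ r * D v + (1 ∸ D v) * unselectedEnds v
  vertexWeight≡ v = begin
    vertexWeight v
      ≡⟨ sum-cong-≗ (λ i → trans (cong₂ _+_ (cong (𝟙 (src i ≟ᶠ v) *_) (weight≡ r (firstIn i) (D v)))
                                            (cong (𝟙 (tgt i ≟ᶠ v) *_) (weight≡ r (lastIn i) (D v))))
                                 (regroup (𝟙 (src i ≟ᶠ v)) (𝟙 (tgt i ≟ᶠ v)) r (1 ∸ D v) _ _ _ _)) ⟩
    ∑[ i < L ] (r * selectedAt v i + (1 ∸ D v) * unselected i)
      ≡⟨ ∑-distrib-+ (λ i → r * selectedAt v i) (λ i → (1 ∸ D v) * unselected i) ⟩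
    ∑[ i < L ] (r * selectedAt v i) + ∑[ i < L ] ((1 ∸ D v) * unselected i)
      ≡⟨ cong₂ _+_ (sym (*-distribˡ-sum r (selectedAt v))) (sym (*-distribˡ-sum (1 ∸ D v) unselected)) ⟩
    r * ∑[ i < L ] selectedAt v i + (1 ∸ D v) * unselectedEnds v
      ≡⟨ cong (λ x → r * x + (1 ∸ D v) * unselectedEnds v) (sym (D≡∑ v)) ⟩
    r * D v + (1 ∸ D v) * unselectedEnds v ∎
    where
    open ≡-Reasoning
    unselected : Fin L → ℕ
    unselected i = 𝟙 (src i ≟ᶠ v) * (1 ∸ bit (firstIn i)) + 𝟙 (tgt i ≟ᶠ v) * (1 ∸ bit (lastIn i))
    regroup : ∀ a b r c x y x′ y′ →
      a * (r * x + c * y) + b * (r * x′ + c * y′) ≡ r * (a * x + b * x′) + c * (a * y + b * y′)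
    regroup = solve-∀

  D+unselectedEnds≡r : ∀ v → D v + unselectedEnds v ≡ r
  D+unselectedEnds≡r v = begin
    D v + unselectedEnds v
      ≡⟨ cong (_+ unselectedEnds v) (D≡∑ v) ⟩
    ∑[ i < L ] selectedAt v i + unselectedEnds v
      ≡⟨ ∑-distrib-+ (λ i → 𝟙 (src i ≟ᶠ v) * bit (firstIn i) + 𝟙 (tgt i ≟ᶠ v) * bit (lastIn i))
                     (λ i → 𝟙 (src i ≟ᶠ v) * (1 ∸ bit (firstIn i)) + 𝟙 (tgt i ≟ᶠ v) * (1 ∸ bit (lastIn i))) ⟨
    ∑[ i < L ] ((𝟙 (src i ≟ᶠ v) * bit (firstIn i) + 𝟙 (tgt i ≟ᶠ v) * bit (lastIn i)) +
                (𝟙 (src i ≟ᶠ v) * (1 ∸ bit (firstIn i)) + 𝟙 (tgt i ≟ᶠ v) * (1 ∸ bit (lastIn i))))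
      ≡⟨ sum-cong-≗ (λ i → trans (+-interchange (𝟙 (src i ≟ᶠ v) * bit (firstIn i)) _ _ _)
                                 (cong₂ _+_ (split (𝟙 (src i ≟ᶠ v)) (firstIn i)) (split (𝟙 (tgt i ≟ᶠ v)) (lastIn i)))) ⟩
    ∑[ i < L ] ends v i
      ≡⟨ degree≡∑ends v ⟨
    degree G v
      ≡⟨ regular v ⟩
    r ∎
    where
    open ≡-Reasoning
    split : ∀ a b → a * bit b + a * (1 ∸ bit b) ≡ a
    split a b = trans (sym (*-distribˡ-+ a (bit b) _)) (trans (cong (a *_) (bit+[1∸bit] b)) (*-identityʳ a))

  vertexWeight≡r : ∀ {v} → D v ≤ 1 → vertexWeight v ≡ r
  vertexWeight≡r {v} D≤1 = trans (vertexWeight≡ v) (by-degree (D v) D≤1 (D+unselectedEnds≡r v))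
    where
    by-degree : ∀ d {z} → d ≤ 1 → d + z ≡ r → r * d + (1 ∸ d) * z ≡ r
    by-degree 0 {z} _ eq = trans (cong (_+ 1 * z) (*-zeroʳ r)) (trans (*-identityˡ z) eq)
    by-degree 1     _ _  = trans (cong (_+ 0) (*-identityʳ r)) (+-identityʳ r)
    by-degree (suc (suc _)) (s≤s ()) _

  selectedAt≥1 : ∀ {i v u} → firstIn i ≡ true → lastIn i ≡ true → IndexJoins i v u → 1 ≤ selectedAt v i
  selectedAt≥1 {i} first-in _ (inj₁ refl) =
    ≤-trans (≤-reflexive (sym (cong₂ (λ a b → a * bit b) (𝟙-yes (src i ≟ᶠ src i) refl) first-in))) (m≤m+n _ _)
  selectedAt≥1 {i} _ last-in (inj₂ refl) =
    ≤-trans (≤-reflexive (sym (cong₂ (λ a b → a * bit b) (𝟙-yes (tgt i ≟ᶠ tgt i) refl) last-in))) (m≤n+m _ _)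

  selectedAt≤D : ∀ v i → selectedAt v i ≤ D v
  selectedAt≤D v i = ≤-trans (≤∑ L (selectedAt v) i) (≤-reflexive (sym (D≡∑ v)))

  n*r≡L*2 : n * r ≡ L * 2
  n*r≡L*2 = begin
    n * r                                   ≡⟨ ∑-const n r ⟨
    ∑[ v < n ] r                            ≡⟨ sum-cong-≗ {n} (λ v → trans (sym (regular v)) (degree≡∑ends v)) ⟩
    ∑[ v < n ] ∑[ i < L ] ends v i
      ≡⟨ sum-cong-≗ {n} (λ v → sum-cong-≗ {L} (ends≡ v)) ⟩
    ∑[ v < n ] ∑[ i < L ] (𝟙 (src i ≟ᶠ v) * 1 + 𝟙 (tgt i ≟ᶠ v) * 1)  ≡⟨ handshake (λ _ _ → 1) (λ _ _ → 1) ⟩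
    ∑[ i < L ] 2                            ≡⟨ ∑-const L 2 ⟩
    L * 2                                   ∎
    where
    open ≡-Reasoning
    ends≡ : ∀ v i → ends v i ≡ 𝟙 (src i ≟ᶠ v) * 1 + 𝟙 (tgt i ≟ᶠ v) * 1
    ends≡ v i = sym (cong₂ _+_ (*-identityʳ (𝟙 (src i ≟ᶠ v))) (*-identityʳ (𝟙 (tgt i ≟ᶠ v))))

  ∑r≡L+L : ∑[ v < n ] r ≡ L + L
  ∑r≡L+L = trans (∑-const n r) (trans n*r≡L*2 (trans (*-comm L 2) (cong (L +_) (+-identityʳ L))))

  ∑pathBound≡ : ∑[ i < L ] pathBound i ≡ (2 * r ∸ 1) * ∑[ i < L ] ε i + L
  ∑pathBound≡ = begin
    ∑[ i < L ] ((2 * r ∸ 1) * ε i + 1)             ≡⟨ ∑-distrib-+ (λ i → (2 * r ∸ 1) * ε i) (λ _ → 1) ⟩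
    ∑[ i < L ] ((2 * r ∸ 1) * ε i) + ∑[ i < L ] 1  ≡⟨ cong₂ _+_ (sym (*-distribˡ-sum (2 * r ∸ 1) ε)) (∑-const L 1) ⟩
    (2 * r ∸ 1) * ∑[ i < L ] ε i + L * 1           ≡⟨ cong ((2 * r ∸ 1) * ∑[ i < L ] ε i +_) (*-identityʳ L) ⟩
    (2 * r ∸ 1) * ∑[ i < L ] ε i + L               ∎
    where open ≡-Reasoning

  size≡∑ε+Lk : (∀ i → k ≤ ones (bits i)) → length P ≡ ∑[ i < L ] ε i + L * k
  size≡∑ε+Lk k≤ones = begin
    length P                            ≡⟨ length≡∑ones ⟩
    ∑[ i < L ] ones (bits i)            ≡⟨ sum-cong-≗ (λ i → sym (m∸n+n≡m (k≤ones i))) ⟩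
    ∑[ i < L ] (ε i + k)                ≡⟨ ∑-distrib-+ ε (λ _ → k) ⟩
    ∑[ i < L ] ε i + ∑[ i < L ] k       ≡⟨ cong (∑[ i < L ] ε i +_) (∑-const L k) ⟩
    ∑[ i < L ] ε i + L * k              ∎
    where open ≡-Reasoning

  -- Both sides of the size equation carry the same term 2(2r−1)Lk, and n r = 2L.
  size-equation⇔ : ∀ {X} → length P ≡ X + L * k →
    (2 * (2 * r ∸ 1) * length P ≡ n * r * (2 * r * k ∸ k + 1)) ⇔ ((2 * r ∸ 1) * X ≡ L)
  size-equation⇔ {X} size = mk⇔
    (λ eq → *-cancelˡ-≡ _ _ 2 (+-cancelʳ-≡ (2 * (c * (L * k))) _ _ (trans (sym lhs) (trans eq rhs))))
    (λ cX≡L → trans lhs (trans (cong (λ x → 2 * x + 2 * (c * (L * k))) cX≡L) (sym rhs)))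
    where
    c = 2 * r ∸ 1
    lhs : 2 * c * length P ≡ 2 * (c * X) + 2 * (c * (L * k))
    lhs = trans (cong (2 * c *_) size) (expand c X L k)
      where
      expand : ∀ c X L k → 2 * c * (X + L * k) ≡ 2 * (c * X) + 2 * (c * (L * k))
      expand = solve-∀
    rhs : n * r * (2 * r * k ∸ k + 1) ≡ 2 * L + 2 * (c * (L * k))
    rhs = trans (cong₂ (λ a b → a * (b + 1)) n*r≡L*2 2rk∸k≡ck) (expand c L k)
      where
      2rk∸k≡ck : 2 * r * k ∸ k ≡ c * k
      2rk∸k≡ck = sym (trans (*-distribʳ-∸ k (2 * r) 1) (cong (2 * r * k ∸_) (*-identityˡ k)))
      expand : ∀ c L k → L * 2 * (c * k + 1) ≡ 2 * L + 2 * (c * (L * k))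
      expand = solve-∀

  module _ (words : ∀ i → PerfectWord (D (src i)) (bits i) (D (tgt i))) where

    unselected-end⇒D≤1 : ∀ v → 1 ≤ unselectedEnds v → D v ≤ 1
    unselected-end⇒D≤1 v h with ∑≥1⇒∃ L _ h
    ... | i , t with +≥1⇒ (𝟙 (src i ≟ᶠ v) * (1 ∸ bit (firstIn i))) t
    ...   | inj₁ t₁ with 𝟙*[1∸bit]≥1⇒ (src i ≟ᶠ v) (firstIn i) t₁
    ...     | refl , out = PerfectWord-first-out (words i) out nonempty
      where nonempty = ≤-trans (s≤s z≤n) (≤-reflexive (sym (length-bits i)))
    unselected-end⇒D≤1 v h | i , t | inj₂ t₂ with 𝟙*[1∸bit]≥1⇒ (tgt i ≟ᶠ v) (lastIn i) t₂
    ...     | refl , out = PerfectWord-last-out (words i) out nonempty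
      where nonempty = ≤-trans (s≤s z≤n) (≤-reflexive (sym (length-bits i)))

module FromPerfectEDS {n : ℕ} (r k : ℕ) (G : Graph n) (regular : Regular r G) (r≥2 : 2 ≤ r)
  {P : List (Edge (subdivVertices (3 * k) G))} (P⊆E : EdgeSubset (subdivEdges (3 * k) G) P)
  (perfect : ∀ f → f ∈ subdivEdges (3 * k) G → f ∉ P → domCount P f ≡ 1)
  (size : 2 * (2 * r ∸ 1) * length P ≡ n * r * (2 * r * k ∸ k + 1)) where

  open PathWeights r k G regular P⊆E
  open EdgeIndexing G using (IndexJoins; Adjacent⇒index; index⇒Adjacent; IndexJoins-other; IndexJoins-both)

  r≥1 : 1 ≤ r
  r≥1 = ≤-trans (s≤s z≤n) r≥2

  words : ∀ i → PerfectWord (D (src i)) (bits i) (D (tgt i))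
  words = perfect⇒PerfectWord perfect

  length-bits≡1+triple : ∀ i → length (bits i) ≡ 1 + triple k
  length-bits≡1+triple i = trans (length-bits i) (cong suc (sym (triple≡3* k)))

  path-bound : ∀ i → pathWeight i ≤ pathBound i
  path-bound i = path-weight-bound r k (bits i) r≥1 (words i) (length-bits≡1+triple i)

  vertex-cases : ∀ v → (D v ≤ 1) ⊎ (vertexWeight v ≡ r * r)
  vertex-cases v with unselectedEnds v in z≡
  ... | suc _ = inj₁ (unselected-end⇒D≤1 words v (subst (1 ≤_) (sym z≡) (s≤s z≤n)))
  ... | zero  = inj₂ (begin
    vertexWeight v                          ≡⟨ vertexWeight≡ v ⟩
    r * D v + (1 ∸ D v) * unselectedEnds v  ≡⟨ cong (λ z → r * D v + (1 ∸ D v) * z) z≡ ⟩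
    r * D v + (1 ∸ D v) * 0                 ≡⟨ cong₂ _+_ (cong (r *_) D≡r) (*-zeroʳ (1 ∸ D v)) ⟩
    r * r + 0                               ≡⟨ +-identityʳ _ ⟩
    r * r                                   ∎)
    where
    open ≡-Reasoning
    D≡r : D v ≡ r
    D≡r = trans (sym (+-identityʳ (D v))) (trans (cong (D v +_) (sym z≡)) (D+unselectedEnds≡r v))

  vertex-bound : ∀ v → r ≤ vertexWeight v
  vertex-bound v with vertex-cases v
  ... | inj₁ D≤1 = ≤-reflexive (sym (vertexWeight≡r D≤1))
  ... | inj₂ eq  = ≤-trans (m≤m*n r r {{>-nonZero r≥1}}) (≤-reflexive (sym eq))

  ∑pathBound≡∑r : ∑[ i < L ] pathBound i ≡ ∑[ v < n ] r
  ∑pathBound≡∑r = trans ∑pathBound≡ (trans (cong (_+ L) c∑ε≡L) (sym ∑r≡L+L))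
    where
    k≤ones : ∀ i → k ≤ ones (bits i)
    k≤ones i = proj₁ (perfect-length-3k+1 k (bits i) (words i) (length-bits≡1+triple i))
    c∑ε≡L : (2 * r ∸ 1) * ∑[ i < L ] ε i ≡ L
    c∑ε≡L = Equivalence.to (size-equation⇔ (size≡∑ε+Lk k≤ones)) size

  vertex-tight : ∀ v → r ≡ vertexWeight v
  vertex-tight = ∑-mono-≤-≡⇒≡ n vertex-bound (≤-antisym (∑-mono-≤ n vertex-bound)
    (≤-trans (≤-reflexive ∑vertexWeight≡∑pathWeight) (≤-trans (∑-mono-≤ L path-bound) (≤-reflexive ∑pathBound≡∑r))))

  path-tight : ∀ i → pathWeight i ≡ pathBound i
  path-tight = ∑-mono-≤-≡⇒≡ L path-bound (≤-antisym (∑-mono-≤ L path-bound)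
    (≤-trans (≤-reflexive ∑pathBound≡∑r)
      (≤-trans (∑-mono-≤ n vertex-bound) (≤-reflexive ∑vertexWeight≡∑pathWeight))))

  D≤1 : ∀ v → D v ≤ 1
  D≤1 v with vertex-cases v
  ... | inj₁ D≤1 = D≤1
  ... | inj₂ eq  = ⊥-elim (<-irrefl (sym r*r≡r) (m<m*n r r {{>-nonZero r≥1}} r≥2))
    where r*r≡r = trans (sym eq) (sym (vertex-tight v))

  endPattern : ∀ i → EndPattern (firstIn i) (lastIn i) (D (src i)) (D (tgt i))
  endPattern i = tight-weight⇒EndPattern r (ε i) (firstIn i) (lastIn i) r≥2 (D≤1 (src i)) (D≤1 (tgt i)) (sym (path-tight i))

  both-selected : ∀ {i} → firstIn i ≡ true ⊎ lastIn i ≡ true → (firstIn i ≡ true) × (lastIn i ≡ true)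
  both-selected {i} = EndPattern-one-selected (endPattern i)

  equal-ends⇒both-selected : ∀ {i u v} → IndexJoins i u v → D u ≡ D v → (firstIn i ≡ true) × (lastIn i ≡ true)
  equal-ends⇒both-selected {i} {u} {v} j Du≡Dv =
    EndPattern-equal-ends (endPattern i) (IndexJoins-both (λ x → D x ≡ D v) j Du≡Dv refl)

  selectedAt⇒neighbour : ∀ {v i} → 1 ≤ selectedAt v i →
    Σ (Fin n) λ u → IndexJoins i v u × (firstIn i ≡ true) × (lastIn i ≡ true)
  selectedAt⇒neighbour {v} {i} h = by-end (selectedAt≥1⇒ h)
    where
    by-end : ((src i ≡ v) × (firstIn i ≡ true)) ⊎ ((tgt i ≡ v) × (lastIn i ≡ true)) →
      Σ (Fin n) λ u → IndexJoins i v u × (firstIn i ≡ true) × (lastIn i ≡ true)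
    by-end (inj₁ (refl , first-in)) = tgt i , inj₁ refl , both-selected (inj₁ first-in)
    by-end (inj₂ (refl , last-in))  = src i , inj₂ refl , both-selected (inj₂ last-in)

  colour : Fin n → Colour
  colour v = colourOf (D v)

  Y⇒D≡1 : ∀ {v} → colour v ≡ Y → D v ≡ 1
  Y⇒D≡1 {v} cv = ≤-antisym (D≤1 v) (colourOf-Y cv)

  noWW : ∀ u v → Adjacent G u v → colour u ≡ W → colour v ≡ W → ⊥
  noWW u v adj cu cv =
    let i , j = Adjacent⇒index adj
        first-in , last-in = equal-ends⇒both-selected j (trans (colourOf-W cu) (sym (colourOf-W cv)))
    in 1+n≰n (≤-trans (selectedAt≥1 first-in last-in j) (≤-trans (selectedAt≤D u i) (≤-reflexive (colourOf-W cu))))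

  neighbour-unique : ∀ {v i u u′} → D v ≡ 1 → 1 ≤ selectedAt v i → IndexJoins i v u →
    Adjacent G v u′ → D u′ ≡ 1 → u′ ≡ u
  neighbour-unique {v} {i} {u} {u′} Dv≡1 t j adj Du′≡1 =
    let i′ , j′ = Adjacent⇒index adj
        first-in′ , last-in′ = equal-ends⇒both-selected j′ (trans Dv≡1 (sym Du′≡1))
        i≡i′ = ∑≤1⇒unique L (selectedAt v) (≤-reflexive (trans (sym (D≡∑ v)) Dv≡1)) i i′ t
                 (selectedAt≥1 first-in′ last-in′ j′)
    in IndexJoins-other j (subst (λ x → IndexJoins x v u′) (sym i≡i′) j′)

  uniqueY : ∀ v → colour v ≡ Y → Σ (Fin n) λ u → Adjacent G v u × colour u ≡ Y ×
    (∀ u′ → Adjacent G v u′ → colour u′ ≡ Y → u′ ≡ u)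
  uniqueY v cv =
    let i , t = ∑≥1⇒∃ L (selectedAt v) (≤-trans (colourOf-Y cv) (≤-reflexive (D≡∑ v)))
        u , j , first-in , last-in = selectedAt⇒neighbour t
        Du≥1 = ≤-trans (selectedAt≥1 first-in last-in (Joins-sym j)) (selectedAt≤D u i)
    in u , index⇒Adjacent j , ≥1⇒colourOf-Y Du≥1 ,
       λ u′ adj cu′ → neighbour-unique (Y⇒D≡1 cv) t j adj (Y⇒D≡1 cu′)

  colouring : Σ (Fin n → Colour) (ColouringII G)
  colouring = colour , noWW , uniqueY


perfectEDS⇒colouring : ∀ {n} r k (G : Graph n) → Regular r G →
  (Σ (List (Edge (subdivVertices (3 * k) G))) λ P →
     IsPerfectEDS (subdivEdges (3 * k) G) P × 2 * (2 * r ∸ 1) * length P ≡ n * r * (2 * r * k ∸ k + 1)) →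
  Σ (Fin n → Colour) (ColouringII G)
perfectEDS⇒colouring zero          k G regular _ = EdgeIndexing.regular-0-colouring G regular
perfectEDS⇒colouring (suc zero)    k G regular _ = EdgeIndexing.regular-1-colouring G regular
perfectEDS⇒colouring r@(suc (suc _)) k G regular (P , (P⊆E , perfect) , size) =
  FromPerfectEDS.colouring r k G regular (s≤s (s≤s z≤n)) P⊆E perfect size

bothY : Colour → Colour → Bool
bothY Y Y = true
bothY _ _ = false

bothY≡true⇒ : ∀ a b → bothY a b ≡ true → (a ≡ Y) × (b ≡ Y)
bothY≡true⇒ Y Y _ = refl , refl

degreeOf : Colour → ℕ
degreeOf Y = 1
degreeOf W = 0

degreeOf≤1 : ∀ a → degreeOf a ≤ 1
degreeOf≤1 Y = s≤s z≤n
degreeOf≤1 W = z≤n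

wordFor : Colour → Colour → ℕ → List Bool
wordFor a b zero    = bothY a b ∷ []
wordFor Y Y (suc k) = true  ∷ false ∷ false ∷ wordFor Y Y k
wordFor Y W (suc k) = false ∷ false ∷ true  ∷ wordFor Y W k
wordFor W b (suc k) = false ∷ true  ∷ false ∷ wordFor W b k

length-wordFor : ∀ a b k → length (wordFor a b k) ≡ 1 + triple k
length-wordFor a b zero    = refl
length-wordFor Y Y (suc k) = cong (3 +_) (length-wordFor Y Y k)
length-wordFor Y W (suc k) = cong (3 +_) (length-wordFor Y W k)
length-wordFor W b (suc k) = cong (3 +_) (length-wordFor W b k)

firstOf-wordFor : ∀ a b k → firstOf (wordFor a b k) ≡ bothY a b
firstOf-wordFor a b zero    = refl
firstOf-wordFor Y Y (suc k) = refl
firstOf-wordFor Y W (suc k) = refl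
firstOf-wordFor W Y (suc k) = refl
firstOf-wordFor W W (suc k) = refl

lastOf-∷ : ∀ c ws → 1 ≤ length ws → lastOf (c ∷ ws) ≡ lastOf ws
lastOf-∷ c (_ ∷ _) _ = refl

wordFor-nonempty : ∀ a b k → 1 ≤ length (wordFor a b k)
wordFor-nonempty a b k = subst (1 ≤_) (sym (length-wordFor a b k)) (s≤s z≤n)

lastOf-wordFor : ∀ a b k → lastOf (wordFor a b k) ≡ bothY a b
lastOf-wordFor a b zero    = refl
lastOf-wordFor Y Y (suc k) = trans (lastOf-∷ false (wordFor Y Y k) (wordFor-nonempty Y Y k)) (lastOf-wordFor Y Y k)
lastOf-wordFor Y W (suc k) = trans (lastOf-∷ true (wordFor Y W k) (wordFor-nonempty Y W k)) (lastOf-wordFor Y W k)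
lastOf-wordFor W b (suc k) = trans (lastOf-∷ false (wordFor W b k) (wordFor-nonempty W b k)) (lastOf-wordFor W b k)

ones-wordFor : ∀ a b k → ones (wordFor a b k) ≡ bit (bothY a b) + k
ones-wordFor a b zero    = refl
ones-wordFor Y Y (suc k) = cong suc (ones-wordFor Y Y k)
ones-wordFor Y W (suc k) = cong suc (ones-wordFor Y W k)
ones-wordFor W b (suc k) = cong suc (ones-wordFor W b k)

wordFor-perfect : ∀ a b k → (a ≡ W → b ≡ W → ⊥) → PerfectWord (degreeOf a) (wordFor a b k) (degreeOf b)
wordFor-perfect Y Y k _    = YY k {1}
  where
  YY : ∀ k {α} → PerfectWord α (wordFor Y Y k) 1
  YY zero          = (λ ()) , tt
  YY (suc zero)    = (λ ()) , (λ _ → refl) , (λ _ → refl) , YY zero {0}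
  YY (suc (suc k)) = (λ ()) , (λ _ → refl) , (λ _ → refl) , YY (suc k) {0}
wordFor-perfect Y W k _    = YW k
  where
  YW : ∀ k → PerfectWord 1 (wordFor Y W k) 0
  YW zero    = (λ _ → refl) , tt
  YW (suc k) = (λ _ → refl) , (λ _ → refl) , (λ ()) , YW k
wordFor-perfect W Y k _    = WY k
  where
  WY : ∀ k → PerfectWord 0 (wordFor W Y k) 1
  WY zero          = (λ _ → refl) , tt
  WY (suc zero)    = (λ _ → refl) , (λ ()) , (λ _ → refl) , WY zero
  WY (suc (suc k)) = (λ _ → refl) , (λ ()) , (λ _ → refl) , WY (suc k)
wordFor-perfect W W k notWW = ⊥-elim (notWW refl refl)

wordFor-tight : ∀ r a b k → (a ≡ W → b ≡ W → ⊥) → 1 ≤ r →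
  weight r (bothY a b) (degreeOf a) + weight r (bothY a b) (degreeOf b) ≡ (2 * r ∸ 1) * (bit (bothY a b) + k ∸ k) + 1
wordFor-tight r Y Y k _ r≥1 = begin
  r + r                        ≡⟨ cong (r +_) (+-identityʳ r) ⟨
  2 * r                        ≡⟨ m∸n+n≡m (≤-trans r≥1 (m≤m+n r (r + 0))) ⟨
  (2 * r ∸ 1) + 1              ≡⟨ cong (λ x → x + 1) (*-identityʳ (2 * r ∸ 1)) ⟨
  (2 * r ∸ 1) * 1 + 1          ≡⟨ cong (λ x → (2 * r ∸ 1) * x + 1) (m+n∸n≡m 1 k) ⟨
  (2 * r ∸ 1) * (1 + k ∸ k) + 1 ∎
  where open ≡-Reasoning
wordFor-tight r Y W k _ _ = sym (cong (_+ 1) (trans (cong ((2 * r ∸ 1) *_) (n∸n≡0 k)) (*-zeroʳ (2 * r ∸ 1))))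
wordFor-tight r W Y k _ _ = sym (cong (_+ 1) (trans (cong ((2 * r ∸ 1) *_) (n∸n≡0 k)) (*-zeroʳ (2 * r ∸ 1))))
wordFor-tight r W W k notWW _ = ⊥-elim (notWW refl refl)

module _ {A : Set} where

  select : List Bool → List A → List A
  select []           _        = []
  select (_ ∷ _)      []       = []
  select (true ∷ bs)  (x ∷ xs) = x ∷ select bs xs
  select (false ∷ bs) (x ∷ xs) = select bs xs

  ∈-select⁻ : ∀ bs {xs : List A} {y} → y ∈ select bs xs → y ∈ xs
  ∈-select⁻ (true ∷ bs)  {x ∷ xs} (here eq) = here eq
  ∈-select⁻ (true ∷ bs)  {x ∷ xs} (there m) = there (∈-select⁻ bs m)
  ∈-select⁻ (false ∷ bs) {x ∷ xs} m         = there (∈-select⁻ bs m)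

  select-unique : ∀ bs {xs : List A} → Unique xs → Unique (select bs xs)
  select-unique []           _          = []
  select-unique (_ ∷ _)      {[]} _     = []
  select-unique (true ∷ bs)  {x ∷ xs} (x∉ ∷ u) =
    All.tabulate (λ y∈ → All.lookup x∉ (∈-select⁻ bs y∈)) ∷ select-unique bs u
  select-unique (false ∷ bs) {x ∷ xs} (_ ∷ u)  = select-unique bs u

  map-does-select : {Q : A → Set} (Q? : Decidable Q) → ∀ bs {xs : List A} → Unique xs → length bs ≡ length xs →
    (∀ {x} → x ∈ xs → (Q x → x ∈ select bs xs) × (x ∈ select bs xs → Q x)) →
    map (λ x → does (Q? x)) xs ≡ bs
  map-does-select Q? [] {[]} _ _ _ = refl
  map-does-select Q? (true ∷ bs) {x ∷ xs} (x∉ ∷ u) len Q⇔ =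
    cong₂ _∷_ (dec-true (Q? x) (proj₂ (Q⇔ (here refl)) (here refl)))
      (map-does-select Q? bs u (suc-injective len) λ y∈ →
        (λ qy → drop-head y∈ (proj₁ (Q⇔ (there y∈)) qy)) , (λ m → proj₂ (Q⇔ (there y∈)) (there m)))
    where
    drop-head : ∀ {y} → y ∈ xs → y ∈ x ∷ select bs xs → y ∈ select bs xs
    drop-head y∈ (here refl) = ⊥-elim (All.lookup x∉ y∈ refl)
    drop-head _  (there m)   = m
  map-does-select Q? (false ∷ bs) {x ∷ xs} (x∉ ∷ u) len Q⇔ =
    cong₂ _∷_ (dec-false (Q? x) (λ qx → All.lookup x∉ (∈-select⁻ bs (proj₁ (Q⇔ (here refl)) qx)) refl))
      (map-does-select Q? bs u (suc-injective len) λ y∈ → Q⇔ (there y∈))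

module FromColouring {n : ℕ} (r k : ℕ) (G : Graph n) (regular : Regular r G)
  (colour : Fin n → Colour) (colouring : ColouringII G colour) where

  private
    module S = Subdivision G (3 * k)
    noWW = proj₁ colouring
    uniqueY = proj₂ colouring

  word : Fin S.L → List Bool
  word i = wordFor (colour (S.src i)) (colour (S.tgt i)) k

  chosen : Fin S.L → List (Edge S.N)
  chosen i = select (word i) (S.path i)

  P : List (Edge S.N)
  P = concatMap chosen (allFin S.L)

  chosen⊆path : ∀ {i e} → e ∈ chosen i → e ∈ S.path i
  chosen⊆path {i} = ∈-select⁻ (word i)

  P⊆E : EdgeSubset S.E P
  P⊆E = concatMap-allFin-unique chosen (λ i → select-unique (word i) (pathEdges-unique (S.path-fresh i)))
          (λ i≢j (e∈i , e∈j) → S.paths-disjoint i≢j (chosen⊆path e∈i , chosen⊆path e∈j)) ,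
        All.tabulate (λ e∈ → let i , e∈i = ∈-concatMap-allFin⁻ chosen e∈ in S.∈E⁺ i (chosen⊆path e∈i))

  open PathWeights r k G regular P⊆E
  open EdgeIndexing G
    using (IndexJoins; Adjacent⇒index; index⇒Adjacent; IndexJoins-unique; IndexJoins-both; IndexJoins⇒ends≡1; ends)

  bits≡word : ∀ i → bits i ≡ word i
  bits≡word i = map-does-select (_∈? P) (word i) (pathEdges-unique (path-fresh i))
    (trans (length-wordFor _ _ k) (trans (cong suc (triple≡3* k)) (trans (sym (length-bits i)) (length-map inP (path i)))))
    λ {e} e∈i → in-chosen e∈i , (λ e∈ch → ∈-concatMap-allFin⁺ chosen i e∈ch)
    where
    in-chosen : ∀ {e} → e ∈ path i → e ∈ P → e ∈ chosen i
    in-chosen e∈i e∈P with ∈-concatMap-allFin⁻ chosen e∈P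
    ... | j , e∈j with i ≟ᶠ j
    ...   | yes refl = e∈j
    ...   | no  i≢j  = ⊥-elim (paths-disjoint i≢j (e∈i , chosen⊆path e∈j))

  bothY-at : Fin L → Bool
  bothY-at i = bothY (colour (src i)) (colour (tgt i))

  firstIn≡bothY-at : ∀ i → firstIn i ≡ bothY-at i
  firstIn≡bothY-at i = trans (cong firstOf (bits≡word i)) (firstOf-wordFor _ _ k)

  lastIn≡bothY-at : ∀ i → lastIn i ≡ bothY-at i
  lastIn≡bothY-at i = trans (cong lastOf (bits≡word i)) (lastOf-wordFor _ _ k)

  selectedAt≥1⇒Y-edge : ∀ {v i} → 1 ≤ selectedAt v i → Σ (Fin n) λ w → IndexJoins i v w × colour v ≡ Y × colour w ≡ Y
  selectedAt≥1⇒Y-edge {v} {i} h = by-end (selectedAt≥1⇒ h)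
    where
    YY = bothY≡true⇒ (colour (src i)) (colour (tgt i))
    by-end : ((src i ≡ v) × (firstIn i ≡ true)) ⊎ ((tgt i ≡ v) × (lastIn i ≡ true)) →
      Σ (Fin n) λ w → IndexJoins i v w × colour v ≡ Y × colour w ≡ Y
    by-end (inj₁ (refl , first-in)) = let cs , ct = YY (trans (sym (firstIn≡bothY-at i)) first-in) in tgt i , inj₁ refl , cs , ct
    by-end (inj₂ (refl , last-in))  = let cs , ct = YY (trans (sym (lastIn≡bothY-at i)) last-in) in src i , inj₂ refl , ct , cs

  D-W : ∀ {v} → colour v ≡ W → D v ≡ 0
  D-W {v} cv = ≱1⇒≡0 λ D≥1 →
    let i , t = ∑≥1⇒∃ L (selectedAt v) (≤-trans D≥1 (≤-reflexive (D≡∑ v)))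
        _ , _ , cv′ , _ = selectedAt≥1⇒Y-edge t
    in W≢Y (trans (sym cv) cv′)

  D-Y : ∀ {v} → colour v ≡ Y → D v ≡ 1
  D-Y {v} cv =
    let u , adj , cu , only = uniqueY v cv
        i₀ , j₀ = Adjacent⇒index adj
        other : ∀ i → i ≢ i₀ → selectedAt v i ≡ 0
        other i i≢i₀ = ≱1⇒≡0 λ t →
          let w , j , _ , cw = selectedAt≥1⇒Y-edge t
          in i≢i₀ (IndexJoins-unique (subst (IndexJoins i v) (only w (index⇒Adjacent j) cw) j) j₀)
        bothY-at₀ : bothY-at i₀ ≡ true
        bothY-at₀ = let cs , ct = IndexJoins-both (λ x → colour x ≡ Y) j₀ cv cu in cong₂ bothY cs ct
        at-i₀ : selectedAt v i₀ ≡ 1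
        at-i₀ = begin
          𝟙 (src i₀ ≟ᶠ v) * bit (firstIn i₀) + 𝟙 (tgt i₀ ≟ᶠ v) * bit (lastIn i₀)
            ≡⟨ cong₂ (λ a b → 𝟙 (src i₀ ≟ᶠ v) * bit a + 𝟙 (tgt i₀ ≟ᶠ v) * bit b)
                     (trans (firstIn≡bothY-at i₀) bothY-at₀) (trans (lastIn≡bothY-at i₀) bothY-at₀) ⟩
          𝟙 (src i₀ ≟ᶠ v) * 1 + 𝟙 (tgt i₀ ≟ᶠ v) * 1
            ≡⟨ cong₂ _+_ (*-identityʳ (𝟙 (src i₀ ≟ᶠ v))) (*-identityʳ (𝟙 (tgt i₀ ≟ᶠ v))) ⟩
          ends v i₀
            ≡⟨ IndexJoins⇒ends≡1 j₀ ⟩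
          1 ∎
    in trans (D≡∑ v) (trans (∑-single L (selectedAt v) i₀ other) at-i₀)
    where open ≡-Reasoning

  D≡degreeOf : ∀ v → D v ≡ degreeOf (colour v)
  D≡degreeOf v = by-colour (colour v) refl
    where
    by-colour : ∀ c → colour v ≡ c → D v ≡ degreeOf c
    by-colour W cv = D-W cv
    by-colour Y cv = D-Y cv

  words : ∀ i → PerfectWord (D (src i)) (bits i) (D (tgt i))
  words i = subst₂ (λ α β → PerfectWord α (bits i) β) (sym (D≡degreeOf (src i))) (sym (D≡degreeOf (tgt i)))
              (subst (λ w → PerfectWord _ w _) (sym (bits≡word i))
                (wordFor-perfect (colour (src i)) (colour (tgt i)) k (noWW (src i) (tgt i) (index⇒Adjacent (inj₁ refl)))))

  isPerfectEDS : IsPerfectEDS (subdivEdges (3 * k) G) P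
  isPerfectEDS = P⊆E , PerfectWord⇒perfect words

  ones≡ : ∀ i → ones (bits i) ≡ bit (bothY-at i) + k
  ones≡ i = trans (cong ones (bits≡word i)) (ones-wordFor _ _ k)

  module _ (r≥1 : 1 ≤ r) where

    path-tight : ∀ i → pathWeight i ≡ pathBound i
    path-tight i = begin
      weight r (firstIn i) (D (src i)) + weight r (lastIn i) (D (tgt i))
        ≡⟨ cong₂ _+_ (cong₂ (weight r) (firstIn≡bothY-at i) (D≡degreeOf (src i)))
                     (cong₂ (weight r) (lastIn≡bothY-at i) (D≡degreeOf (tgt i))) ⟩
      weight r (bothY-at i) (degreeOf (colour (src i))) + weight r (bothY-at i) (degreeOf (colour (tgt i)))
        ≡⟨ wordFor-tight r (colour (src i)) (colour (tgt i)) k (noWW (src i) (tgt i) (index⇒Adjacent (inj₁ refl))) r≥1 ⟩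
      (2 * r ∸ 1) * (bit (bothY-at i) + k ∸ k) + 1
        ≡⟨ cong (λ x → (2 * r ∸ 1) * (x ∸ k) + 1) (ones≡ i) ⟨
      pathBound i ∎
      where open ≡-Reasoning

    size : 2 * (2 * r ∸ 1) * length P ≡ n * r * (2 * r * k ∸ k + 1)
    size = Equivalence.from (size-equation⇔ (size≡∑ε+Lk k≤ones)) c∑ε≡L
      where
      k≤ones : ∀ i → k ≤ ones (bits i)
      k≤ones i = ≤-trans (m≤n+m k _) (≤-reflexive (sym (ones≡ i)))
      ∑pathBound≡∑r : ∑[ i < L ] pathBound i ≡ ∑[ v < n ] r
      ∑pathBound≡∑r = trans (sum-cong-≗ (λ i → sym (path-tight i)))
        (trans (sym ∑vertexWeight≡∑pathWeight)
          (sum-cong-≗ (λ v → vertexWeight≡r (≤-trans (≤-reflexive (D≡degreeOf v)) (degreeOf≤1 (colour v))))))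
      c∑ε≡L : (2 * r ∸ 1) * ∑[ i < L ] ε i ≡ L
      c∑ε≡L = +-cancelʳ-≡ L _ _ (trans (sym ∑pathBound≡) (trans ∑pathBound≡∑r ∑r≡L+L))

colouring⇒perfectEDS : ∀ {n} r k (G : Graph n) → Regular r G → Σ (Fin n → Colour) (ColouringII G) →
  Σ (List (Edge (subdivVertices (3 * k) G))) λ P →
    IsPerfectEDS (subdivEdges (3 * k) G) P × 2 * (2 * r ∸ 1) * length P ≡ n * r * (2 * r * k ∸ k + 1)
colouring⇒perfectEDS {n} zero k G regular (c , cII) =
  FromColouring.P 0 k G regular c cII , FromColouring.isPerfectEDS 0 k G regular c cII , sym (cong (_* (2 * 0 * k ∸ k + 1)) (*-zeroʳ n))
colouring⇒perfectEDS r@(suc _) k G regular (c , cII) =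
  FromColouring.P r k G regular c cII , FromColouring.isPerfectEDS r k G regular c cII ,
  FromColouring.size r k G regular c cII (s≤s z≤n)

corollary9 : (n r k : ℕ) (G : Graph n) → Regular r G →
    ((Σ (List (Edge (subdivVertices (3 * k) G))) λ P →
        IsPerfectEDS (subdivEdges (3 * k) G) P ×
        2 * (2 * r ∸ 1) * length P ≡ n * r * (2 * r * k ∸ k + 1))
      ⇔ (Σ (Fin n → Colour) λ c → ColouringII G c))
    ×
    ((Σ (Fin n → Colour) λ c → ColouringII G c)
      ⇔ (Σ (List (Edge n)) λ P → IsEfficientEDS (edges G) P))
corollary9 n r k G regular =
  mk⇔ (perfectEDS⇒colouring r k G regular) (colouring⇒perfectEDS r k G regular) ,
  mk⇔ (λ (c , cII) → ColouringII⇔EfficientEDS.efficientEDS G c cII)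
      (λ (M , efficient) → ColouringII⇔EfficientEDS.colouring G efficient)
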